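{- Let $G$ be a simple connected graph with $|E(G)|\ge2$ and let $v\in V(G)$. Let $\bar G$ be obtained from $G$ by attaching three new pendant vertices $a,b,c$ to $v$, let $\widehat G=\bar G+\{a,b\}+\{b,c\}$, and let $G^*=\bar G+\{a,b\}+\{b,c\}+\{a,c\}$. Then $\mathscr{K}(G^*)>\mathscr{K}(\widehat G)$.
   Context: For connected $H$ with $m\ge1$ edges and degrees $d_i$, Kemeny's constant is $\mathscr{K}(H)=\sum_j\pi_jm_{ij}$ for the simple random walk on $H$ ($\pi_j=d_j/2m$, $m_{ij}$ expected hitting time of $j$ from $i$, $m_{jj}=0$), equivalently $\frac1{4m}\sum_{i,j}d_id_jr_H(i,j)$ with $r_H$ effective resistance. $H+\{x,y\}$ denotes $H$ with the edge $\{x,y\}$ added. -}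

module Defs where

open import Data.Nat as ℕ using (ℕ; zero; suc; _<ᵇ_)
open import Data.Integer using (+_)
open import Data.Bool using (Bool; true; false; _∧_; _∨_; if_then_else_)
open import Data.Fin using (Fin; zero; suc; toℕ)
open import Data.Fin.Properties renaming (_≟_ to _≟ᶠ_)
open import Data.Rational using (ℚ; 0ℚ; 1ℚ; _+_; _*_; _/_; 1/_; ≢-nonZero)
open import Data.Rational.Properties renaming (_≟_ to _≟ℚ_)
open import Relation.Nullary using (yes; no; ¬_)
open import Relation.Nullary.Decidable using (⌊_⌋)
open import Relation.Binary.PropositionalEquality using (_≡_)
open import Data.Product using (_×_)

Adj : ℕ → Set
Adj n = Fin n → Fin n → Bool

IsSimple : ∀ {n} → Adj n → Set
IsSimple {n} A = (∀ (i j : Fin n) → A i j ≡ A j i) × (∀ (i : Fin n) → A i i ≡ false)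

data Reachable {n} (A : Adj n) : Fin n → Fin n → Set where
  here : ∀ {i} → Reachable A i i
  step : ∀ {i k j} → A i k ≡ true → Reachable A k j → Reachable A i j

Connected : ∀ {n} → Adj n → Set
Connected {n} A = ∀ (i j : Fin n) → Reachable A i j

sumℕ : ∀ {n} → (Fin n → ℕ) → ℕ
sumℕ {zero} f = 0
sumℕ {suc n} f = f zero ℕ.+ sumℕ (λ i → f (suc i))

sumℚ : ∀ {n} → (Fin n → ℚ) → ℚ
sumℚ {zero} f = 0ℚ
sumℚ {suc n} f = f zero + sumℚ (λ i → f (suc i))

b2ℕ : Bool → ℕ
b2ℕ true = 1
b2ℕ false = 0

deg : ∀ {n} → Adj n → Fin n → ℕ
deg A i = sumℕ (λ j → b2ℕ (A i j))

numEdges : ∀ {n} → Adj n → ℕ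
numEdges A = sumℕ (λ i → sumℕ (λ j → b2ℕ ((toℕ i <ᵇ toℕ j) ∧ A i j)))

toℚ : ℕ → ℚ
toℚ k = + k / 1

-- reciprocal with the convention inv 0 = 0 (only ever applied to nonzero values here)
inv : ℚ → ℚ
inv p with p ≟ℚ 0ℚ
... | yes _ = 0ℚ
... | no p≢0 = 1/_ p {{≢-nonZero p≢0}}

-- h i j = expected hitting time of j from i for the simple random walk on A,
-- characterised by the first-step equations: h j j = 0 and, for i ≠ j,
-- h i j = 1 + Σ_k P(i,k) h k j with P(i,k) = [i ~ k] / d_i.
IsHittingTimes : ∀ {n} → Adj n → (Fin n → Fin n → ℚ) → Set
IsHittingTimes {n} A h =
  (∀ (j : Fin n) → h j j ≡ 0ℚ) ×
  (∀ (i j : Fin n) → ¬ (i ≡ j) →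
     h i j ≡ 1ℚ + sumℚ (λ k → (toℚ (b2ℕ (A i k)) * inv (toℚ (deg A i))) * h k j))

-- Kemeny's constant computed from starting vertex i: Σ_j π_j h i j, π_j = d_j / 2m
kemenyAt : ∀ {n} → Adj n → (Fin n → Fin n → ℚ) → Fin n → ℚ
kemenyAt A h i =
  sumℚ (λ j → (toℚ (deg A j) * inv (toℚ (2 ℕ.* numEdges A))) * h i j)

-- Ḡ: vertex set Fin (3 + n); 0 = a, 1 = b, 2 = c, suc (suc (suc i)) = old vertex i.
-- a, b, c are pendant vertices attached to v.
barAdj : ∀ {n} → Adj n → Fin n → Adj (3 ℕ.+ n)
barAdj A v (suc (suc (suc i))) (suc (suc (suc j))) = A i j
barAdj A v (suc (suc (suc i))) _ = ⌊ i ≟ᶠ v ⌋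
barAdj A v _ (suc (suc (suc j))) = ⌊ j ≟ᶠ v ⌋
barAdj A v _ _ = false

addEdge : ∀ {n} → Adj n → Fin n → Fin n → Adj n
addEdge A x y i j = A i j ∨ (⌊ i ≟ᶠ x ⌋ ∧ ⌊ j ≟ᶠ y ⌋) ∨ (⌊ i ≟ᶠ y ⌋ ∧ ⌊ j ≟ᶠ x ⌋)

va vb vc : ∀ {n} → Fin (3 ℕ.+ n)
va = zero
vb = suc zero
vc = suc (suc zero)

hatAdj : ∀ {n} → Adj n → Fin n → Adj (3 ℕ.+ n)
hatAdj A v = addEdge (addEdge (barAdj A v) va vb) vb vc

starAdj : ∀ {n} → Adj n → Fin n → Adj (3 ℕ.+ n)
starAdj A v = addEdge (hatAdj A v) va vc

-- Both graphs are G with a three-vertex gadget hung on v: the path a–b–c in Ĝ and the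
-- triangle abc in G*.  Kemeny's constant does not depend on the starting vertex, since
-- i ↦ Σ_j d_j h(i, j) is harmonic (Kac's formula takes care of j = i) and hence constant by
-- the minimum principle; so both constants are evaluated from v.  Write μ = |E(G)|.
--   * Inside the gadgets the first-step equations and Kac's formula at a, b, c give
--     h(v, a) = h(v, c) = 5μ/4 + 4 and h(v, b) = μ + 5/2 in Ĝ, and h(v, x) = μ + 3 in G*.
--   * The hitting time of an old vertex t in G* is (1 + ε) h(x, t) + ε (h(t, v) - h(x, v)),
--     where h are the hitting times in Ĝ and ε = 1/(μ + 5): the two walks differ only in the
--     length of their excursions from v into the gadget (4 steps instead of 10/3 on average).
--     It suffices to check the first-step equations, whose solution is unique.
-- Weighting with the degrees and clearing the denominators 2μ + 10 and 2μ + 12 leaves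
--   (2μ + 10) Σ_x d*_x h*(v, x) - (2μ + 12) Σ_x d_x h(v, x) = 2B + 2μ² + μ - 12
-- with B = Σ_j d_j h(j, v) ≥ 2μ - d_v ≥ μ, which is positive because μ ≥ 2.

{-# OPTIONS --safe #-}
module Submission where

open import Defs

-- Rational arithmetic is opened only inside this anonymous module, so that the theorem at
-- the end is read with the _+_ and _≤_ of ℕ.
module _ where

  open import Agda.Builtin.FromNat using (Number; fromNat)
  open import Algebra.Bundles using (CommutativeRing)
  open import Data.Bool.Base using (Bool; true; false; T; _∧_)
  open import Data.Bool.Properties as Bool using (∨-identityʳ)
  open import Data.Empty using (⊥-elim)
  open import Data.Fin.Base using (Fin; zero; suc; toℕ; _↑ˡ_; _↑ʳ_)
  open import Data.Fin.Properties using (suc-injective; toℕ-injective; all?) renaming (_≟_ to _≟ᶠ_)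
  open import Data.Integer.Base as ℤ using (ℤ)
  import Data.Integer.Literals as ℤ
  import Data.Integer.Properties as ℤ
  open import Data.Nat.Base as ℕ using (ℕ; _<ᵇ_)
  import Data.Nat.Coprimality as Coprime
  import Data.Nat.Literals as ℕ
  import Data.Nat.Properties as ℕ
  open import Data.Product.Base using (_×_; _,_; proj₁; proj₂; Σ-syntax)
  open import Data.Rational.Base
    using (ℚ; 0ℚ; 1ℚ; _+_; _*_; -_; _-_; _/_; _≤_; _<_; 1/_; ≢-nonZero; nonNegative; positive)
  open import Data.Rational.Literals as ℚ using (fromℤ)
  open import Data.Rational.Properties
  open import Data.Sum.Base using (inj₁; inj₂)
  open import Data.Unit.Base using (tt)
  open import Function.Base using (_∘_; id; case_of_)
  open import Function.Bundles using (_⇔_; mk⇔; Equivalence)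
  open import Level using (0ℓ)
  open import Relation.Binary.PropositionalEquality hiding ([_])
  open import Relation.Nullary using (¬_; yes; no; Dec; _×-dec_)
  open import Relation.Nullary.Decidable using (dec⇒maybe; ⌊_⌋; from-yes)
  open import Tactic.RingSolver using (solve-∀)
  import Tactic.RingSolver.Core.AlmostCommutativeRing as ACR

  open import Algebra.Properties.Semiring.Sum (CommutativeRing.semiring +-*-commutativeRing)
    using (sum; sum-syntax; sum-cong-≗; sum-replicate-zero; ∑-distrib-+; ∑-comm; *-distribˡ-sum; *-distribʳ-sum)

  instance
    ℕ-number : Number ℕ
    ℕ-number = ℕ.number
    ℚ-number : Number ℚ
    ℚ-number = ℚ.number
    ℤ-number : Number ℤ
    ℤ-number = ℤ.number

  ℚ-ring : ACR.AlmostCommutativeRing 0ℓ 0ℓ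
  ℚ-ring = ACR.fromCommutativeRing +-*-commutativeRing (λ x → dec⇒maybe (0ℚ ≟ x))

  sumℚ≡sum : ∀ {n} (f : Fin n → ℚ) → sumℚ f ≡ sum f
  sumℚ≡sum {ℕ.zero}  f = refl
  sumℚ≡sum {ℕ.suc n} f = cong (_+_ (f zero)) (sumℚ≡sum (f ∘ suc))

  ∑-distrib-sub : ∀ {n} (f g : Fin n → ℚ) → ∑[ i < n ] (f i - g i) ≡ ∑[ i < n ] f i - ∑[ i < n ] g i
  ∑-distrib-sub {ℕ.zero}  f g = refl
  ∑-distrib-sub {ℕ.suc n} f g =
    trans (cong (_+_ (f zero - g zero)) (∑-distrib-sub (f ∘ suc) (g ∘ suc)))
          (regroup (f zero) (g zero) (∑[ i < n ] f (suc i)) (∑[ i < n ] g (suc i)))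
    where
    regroup : ∀ a b c d → (a - b) + (c - d) ≡ (a + c) - (b + d)
    regroup = solve-∀ ℚ-ring

  ∑-linear : ∀ {n} (w X Y : Fin n → ℚ) (α β γ : ℚ) →
    ∑[ k < n ] (w k * (α * X k + β * Y k + γ))
      ≡ α * ∑[ k < n ] (w k * X k) + β * ∑[ k < n ] (w k * Y k) + γ * ∑[ k < n ] w k
  ∑-linear {n} w X Y α β γ = begin
    ∑[ k < n ] (w k * (α * X k + β * Y k + γ))
      ≡⟨ sum-cong-≗ (λ k → expand (w k) (X k) (Y k) α β γ) ⟩
    ∑[ k < n ] (α * (w k * X k) + β * (w k * Y k) + γ * w k)
      ≡⟨ ∑-distrib-+ (λ k → α * (w k * X k) + β * (w k * Y k)) (λ k → γ * w k) ⟩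
    ∑[ k < n ] (α * (w k * X k) + β * (w k * Y k)) + ∑[ k < n ] (γ * w k)
      ≡⟨ cong (_+ ∑[ k < n ] (γ * w k)) (∑-distrib-+ (λ k → α * (w k * X k)) (λ k → β * (w k * Y k))) ⟩
    ∑[ k < n ] (α * (w k * X k)) + ∑[ k < n ] (β * (w k * Y k)) + ∑[ k < n ] (γ * w k)
      ≡⟨ sym (cong₂ _+_ (cong₂ _+_ (*-distribˡ-sum α (λ k → w k * X k)) (*-distribˡ-sum β (λ k → w k * Y k)))
                        (*-distribˡ-sum γ w)) ⟩
    α * ∑[ k < n ] (w k * X k) + β * ∑[ k < n ] (w k * Y k) + γ * ∑[ k < n ] w k ∎
    where
    open ≡-Reasoning
    expand : ∀ w x y a b c → w * (a * x + b * y + c) ≡ a * (w * x) + b * (w * y) + c * w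
    expand = solve-∀ ℚ-ring

  ∑-weighted-sub : ∀ {n} (w f g : Fin n → ℚ) →
    ∑[ k < n ] (w k * (f k - g k)) ≡ ∑[ k < n ] (w k * f k) - ∑[ k < n ] (w k * g k)
  ∑-weighted-sub w f g =
    trans (sum-cong-≗ (λ k → expand (w k) (f k) (g k))) (∑-distrib-sub (λ k → w k * f k) (λ k → w k * g k))
    where
    expand : ∀ w x y → w * (x - y) ≡ w * x - w * y
    expand = solve-∀ ℚ-ring

  ∑-mono-≤ : ∀ {n} {f g : Fin n → ℚ} → (∀ i → f i ≤ g i) → ∑[ i < n ] f i ≤ ∑[ i < n ] g i
  ∑-mono-≤ {ℕ.zero}  f≤g = ≤-refl
  ∑-mono-≤ {ℕ.suc n} f≤g = +-mono-≤ (f≤g zero) (∑-mono-≤ (f≤g ∘ suc))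

  ∑-nonneg : ∀ {n} {f : Fin n → ℚ} → (∀ i → 0ℚ ≤ f i) → 0ℚ ≤ ∑[ i < n ] f i
  ∑-nonneg {n} {f} 0≤f = subst (_≤ ∑[ i < n ] f i) (sum-replicate-zero n) (∑-mono-≤ 0≤f)

  term≤∑ : ∀ {n} {f : Fin n → ℚ} → (∀ i → 0ℚ ≤ f i) → ∀ t → f t ≤ ∑[ i < n ] f i
  term≤∑ {ℕ.suc n} {f} 0≤f zero    =
    subst (_≤ ∑[ i < ℕ.suc n ] f i) (+-identityʳ (f zero)) (+-monoʳ-≤ (f zero) (∑-nonneg (0≤f ∘ suc)))
  term≤∑ {ℕ.suc n} {f} 0≤f (suc t) =
    subst (_≤ ∑[ i < ℕ.suc n ] f i) (+-identityˡ (f (suc t))) (+-mono-≤ (0≤f zero) (term≤∑ (0≤f ∘ suc) t))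

  ∑-single : ∀ {n} (f : Fin n → ℚ) t → (∀ i → i ≢ t → f i ≡ 0ℚ) → ∑[ i < n ] f i ≡ f t
  ∑-single {ℕ.suc n} f zero    f≡0 =
    trans (cong (_+_ (f zero)) (trans (sum-cong-≗ (λ i → f≡0 (suc i) λ ())) (sum-replicate-zero n)))
          (+-identityʳ (f zero))
  ∑-single {ℕ.suc n} f (suc t) f≡0 =
    trans (cong₂ _+_ (f≡0 zero λ ()) (∑-single (f ∘ suc) t (λ i i≢t → f≡0 (suc i) (i≢t ∘ suc-injective))))
          (+-identityˡ (f (suc t)))

  p-q≡0⇒p≡q : ∀ {p q} → p - q ≡ 0ℚ → p ≡ q
  p-q≡0⇒p≡q {p} {q} p-q≡0 = trans (sym (cancel p q)) (trans (cong (_+ q) p-q≡0) (+-identityˡ q))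
    where
    cancel : ∀ p q → p - q + q ≡ p
    cancel = solve-∀ ℚ-ring

  p≤q⇒p-q≤0 : ∀ {p q} → p ≤ q → p - q ≤ 0ℚ
  p≤q⇒p-q≤0 {p} {q} p≤q = subst (p - q ≤_) (+-inverseʳ q) (+-monoˡ-≤ (- q) p≤q)

  p-q≤0⇒p≤q : ∀ {p q} → p - q ≤ 0ℚ → p ≤ q
  p-q≤0⇒p≤q {p} {q} p-q≤0 = subst₂ _≤_ (cancel p q) (+-identityˡ q) (+-monoˡ-≤ q p-q≤0)
    where
    cancel : ∀ p q → p - q + q ≡ p
    cancel = solve-∀ ℚ-ring

  p≤q⇒0≤q-p : ∀ {p q} → p ≤ q → 0ℚ ≤ q - p
  p≤q⇒0≤q-p {p} {q} p≤q = subst (_≤ q - p) (+-inverseʳ p) (+-monoˡ-≤ (- p) p≤q)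

  0≤q-p⇒p≤q : ∀ {p q} → 0ℚ ≤ q - p → p ≤ q
  0≤q-p⇒p≤q {p} {q} 0≤q-p = subst₂ _≤_ (+-identityˡ p) (cancel q p) (+-monoˡ-≤ p 0≤q-p)
    where
    cancel : ∀ q p → q - p + p ≡ q
    cancel = solve-∀ ℚ-ring

  0<q-p⇒p<q : ∀ {p q} → 0ℚ < q - p → p < q
  0<q-p⇒p<q {p} {q} 0<q-p = subst₂ _<_ (+-identityˡ p) (cancel q p) (+-monoˡ-< p 0<q-p)
    where
    cancel : ∀ q p → q - p + p ≡ q
    cancel = solve-∀ ℚ-ring

  0≤*0≤ : ∀ {p q} → 0ℚ ≤ p → 0ℚ ≤ q → 0ℚ ≤ p * q
  0≤*0≤ {p} {q} 0≤p 0≤q =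
    nonNegative⁻¹ (p * q) {{nonNeg*nonNeg⇒nonNeg p {{nonNegative 0≤p}} q {{nonNegative 0≤q}}}}

  combine₁ : ∀ {x y l₁ r₁} c₁ → x - y ≡ c₁ * (l₁ - r₁) → l₁ ≡ r₁ → x ≡ y
  combine₁ {r₁ = r₁} c₁ x-y≡ refl = p-q≡0⇒p≡q (trans x-y≡ (vanish c₁ r₁))
    where
    vanish : ∀ c r → c * (r - r) ≡ 0ℚ
    vanish = solve-∀ ℚ-ring

  combine₂ : ∀ {x y l₁ r₁ l₂ r₂} c₁ c₂ → x - y ≡ c₁ * (l₁ - r₁) + c₂ * (l₂ - r₂) →
    l₁ ≡ r₁ → l₂ ≡ r₂ → x ≡ y
  combine₂ {r₁ = r₁} {r₂ = r₂} c₁ c₂ x-y≡ refl refl = p-q≡0⇒p≡q (trans x-y≡ (vanish c₁ r₁ c₂ r₂))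
    where
    vanish : ∀ c r c′ r′ → c * (r - r) + c′ * (r′ - r′) ≡ 0ℚ
    vanish = solve-∀ ℚ-ring

  combine₃ : ∀ {x y l₁ r₁ l₂ r₂ l₃ r₃} c₁ c₂ c₃ →
    x - y ≡ c₁ * (l₁ - r₁) + c₂ * (l₂ - r₂) + c₃ * (l₃ - r₃) →
    l₁ ≡ r₁ → l₂ ≡ r₂ → l₃ ≡ r₃ → x ≡ y
  combine₃ {r₁ = r₁} {r₂ = r₂} {r₃ = r₃} c₁ c₂ c₃ x-y≡ refl refl refl =
    p-q≡0⇒p≡q (trans x-y≡ (vanish c₁ r₁ c₂ r₂ c₃ r₃))
    where
    vanish : ∀ c r c′ r′ c″ r″ → c * (r - r) + c′ * (r′ - r′) + c″ * (r″ - r″) ≡ 0ℚ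
    vanish = solve-∀ ℚ-ring

  combine₄ : ∀ {x y l₁ r₁ l₂ r₂ l₃ r₃ l₄ r₄} c₁ c₂ c₃ c₄ →
    x - y ≡ c₁ * (l₁ - r₁) + c₂ * (l₂ - r₂) + c₃ * (l₃ - r₃) + c₄ * (l₄ - r₄) →
    l₁ ≡ r₁ → l₂ ≡ r₂ → l₃ ≡ r₃ → l₄ ≡ r₄ → x ≡ y
  combine₄ {r₁ = r₁} {r₂ = r₂} {r₃ = r₃} {r₄ = r₄} c₁ c₂ c₃ c₄ x-y≡ refl refl refl refl =
    p-q≡0⇒p≡q (trans x-y≡ (vanish c₁ r₁ c₂ r₂ c₃ r₃ c₄ r₄))
    where
    vanish : ∀ c r c′ r′ c″ r″ c‴ r‴ → c * (r - r) + c′ * (r′ - r′) + c″ * (r″ - r″) + c‴ * (r‴ - r‴) ≡ 0ℚ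
    vanish = solve-∀ ℚ-ring

  *-inv : ∀ q → q ≢ 0ℚ → q * inv q ≡ 1ℚ
  *-inv q q≢0 with q ≟ 0ℚ
  ... | yes q≡0 = ⊥-elim (q≢0 q≡0)
  ... | no  q≢0 = *-inverseʳ q {{≢-nonZero q≢0}}

  toℚ-+ : ∀ m n → toℚ (m ℕ.+ n) ≡ toℚ m + toℚ n
  toℚ-+ m n = begin
    toℚ (m ℕ.+ n)
      ≡⟨ /-cong {ℤ.+ (m ℕ.+ n)} {1} {ℤ.+ m ℤ.* ℤ.+ 1 ℤ.+ ℤ.+ n ℤ.* ℤ.+ 1} {1} num refl ⟩
    (ℤ.+ m ℤ.* ℤ.+ 1 ℤ.+ ℤ.+ n ℤ.* ℤ.+ 1) / 1
      ≡⟨⟩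
    fromℤ (ℤ.+ m) + fromℤ (ℤ.+ n)
      ≡⟨ sym (cong₂ _+_ (toℚ≡fromℤ m) (toℚ≡fromℤ n)) ⟩
    toℚ m + toℚ n ∎
    where
    open ≡-Reasoning
    toℚ≡fromℤ : ∀ k → toℚ k ≡ fromℤ (ℤ.+ k)
    toℚ≡fromℤ k = normalize-coprime (Coprime.sym (Coprime.1-coprimeTo k))
    num : ℤ.+ (m ℕ.+ n) ≡ ℤ.+ m ℤ.* ℤ.+ 1 ℤ.+ ℤ.+ n ℤ.* ℤ.+ 1
    num = sym (cong₂ ℤ._+_ (ℤ.*-identityʳ (ℤ.+ m)) (ℤ.*-identityʳ (ℤ.+ n)))

  toℚ-nonneg : ∀ m → 0ℚ ≤ toℚ m
  toℚ-nonneg m = nonNegative⁻¹ (toℚ m) {{normalize-nonNeg m 1}}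

  toℚ-mono-≤ : ∀ {m n} → m ℕ.≤ n → toℚ m ≤ toℚ n
  toℚ-mono-≤ {m} m≤n =
    subst (λ k → toℚ m ≤ toℚ k) (proj₂ (ℕ.m≤n⇒∃[o]m+o≡n m≤n)) (≤+ (proj₁ (ℕ.m≤n⇒∃[o]m+o≡n m≤n)))
    where
    ≤+ : ∀ o → toℚ m ≤ toℚ (m ℕ.+ o)
    ≤+ o = subst₂ _≤_ (+-identityʳ (toℚ m)) (sym (toℚ-+ m o)) (+-monoʳ-≤ (toℚ m) (toℚ-nonneg o))

  toℚ-sum : ∀ {n} (f : Fin n → ℕ) → toℚ (sumℕ f) ≡ ∑[ i < n ] toℚ (f i)
  toℚ-sum {ℕ.zero}  f = refl
  toℚ-sum {ℕ.suc n} f = trans (toℚ-+ (f zero) _) (cong (_+_ (toℚ (f zero))) (toℚ-sum (f ∘ suc)))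

  [_] : Bool → ℚ
  [ b ] = toℚ (b2ℕ b)

  []-nonneg : ∀ b → 0ℚ ≤ [ b ]
  []-nonneg b = toℚ-nonneg (b2ℕ b)

  degℚ : ∀ {n} → Adj n → Fin n → ℚ
  degℚ A i = toℚ (deg A i)

  degℚ≡∑ : ∀ {n} (A : Adj n) i → degℚ A i ≡ ∑[ k < n ] [ A i k ]
  degℚ≡∑ A i = toℚ-sum (λ k → b2ℕ (A i k))

  degℚ-nonneg : ∀ {n} (A : Adj n) i → 0ℚ ≤ degℚ A i
  degℚ-nonneg A i = toℚ-nonneg (deg A i)

  edge-split : ∀ {n} {A : Adj n} → IsSimple A → ∀ i j →
    b2ℕ (A i j) ≡ b2ℕ ((toℕ i <ᵇ toℕ j) ∧ A i j) ℕ.+ b2ℕ ((toℕ j <ᵇ toℕ i) ∧ A j i)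
  edge-split {A = A} (symmetric , loopless) i j
    with toℕ i <ᵇ toℕ j in i<j | toℕ j <ᵇ toℕ i in j<i
  ... | true  | true  = ⊥-elim (ℕ.<-asym (ℕ.<ᵇ⇒< (toℕ i) (toℕ j) (T-≡ i<j)) (ℕ.<ᵇ⇒< (toℕ j) (toℕ i) (T-≡ j<i)))
    where
    T-≡ : ∀ {b} → b ≡ true → T b
    T-≡ refl = _
  ... | true  | false = sym (ℕ.+-identityʳ (b2ℕ (A i j)))
  ... | false | true  = cong b2ℕ (symmetric i j)
  ... | false | false with toℕ-injective {i = i} {j = j} (ℕ.≤-antisym (ℕ.≮⇒≥ (≮ j<i)) (ℕ.≮⇒≥ (≮ i<j)))
    where
    ≮ : ∀ {m n} → (m <ᵇ n) ≡ false → ¬ m ℕ.< n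
    ≮ m≮n m<n = subst T m≮n (ℕ.<⇒<ᵇ m<n)
  ...   | refl = cong b2ℕ (loopless i)

  toℚ-2* : ∀ m → toℚ (2 ℕ.* m) ≡ 2 * toℚ m
  toℚ-2* m = trans (toℚ-+ m (m ℕ.+ 0)) (trans (cong (toℚ m +_) (cong toℚ (ℕ.+-identityʳ m))) (double (toℚ m)))
    where
    double : ∀ x → x + x ≡ 2 * x
    double = solve-∀ ℚ-ring

  handshake : ∀ {n} {A : Adj n} → IsSimple A → ∑[ i < n ] degℚ A i ≡ 2 * toℚ (numEdges A)
  handshake {n} {A} simple = begin
    ∑[ i < n ] degℚ A i
      ≡⟨ sum-cong-≗ (degℚ≡∑ A) ⟩
    ∑[ i < n ] ∑[ j < n ] [ A i j ]
      ≡⟨ sum-cong-≗ (λ i → sum-cong-≗ (λ j → trans (cong toℚ (edge-split simple i j)) (toℚ-+ (b2ℕ (E′ i j)) (b2ℕ (E′ j i))))) ⟩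
    ∑[ i < n ] ∑[ j < n ] (E i j + E j i)
      ≡⟨ sum-cong-≗ (λ i → ∑-distrib-+ (E i) (λ j → E j i)) ⟩
    ∑[ i < n ] (∑[ j < n ] E i j + ∑[ j < n ] E j i)
      ≡⟨ ∑-distrib-+ (λ i → ∑[ j < n ] E i j) (λ i → ∑[ j < n ] E j i) ⟩
    ∑E + ∑[ i < n ] ∑[ j < n ] E j i
      ≡⟨ cong (∑E +_) (∑-comm (λ i j → E j i)) ⟩
    ∑E + ∑E
      ≡⟨ double ∑E ⟩
    2 * ∑E
      ≡⟨ cong (2 *_) (sym edges) ⟩
    2 * toℚ (numEdges A) ∎
    where
    open ≡-Reasoning
    E′ : Fin n → Fin n → Bool
    E′ i j = (toℕ i <ᵇ toℕ j) ∧ A i j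
    E : Fin n → Fin n → ℚ
    E i j = [ E′ i j ]
    ∑E : ℚ
    ∑E = ∑[ i < n ] ∑[ j < n ] E i j
    edges : toℚ (numEdges A) ≡ ∑E
    edges = trans (toℚ-sum (λ i → sumℕ (λ j → b2ℕ (E′ i j)))) (sum-cong-≗ (λ i → toℚ-sum (λ j → b2ℕ (E′ i j))))
    double : ∀ x → x + x ≡ 2 * x
    double = solve-∀ ℚ-ring

  -- Hitting times and Kemeny's constant

  FirstStepAt : ∀ {n} → Adj n → (Fin n → ℚ) → Fin n → Set
  FirstStepAt {n} A g i = degℚ A i * g i ≡ degℚ A i + ∑[ k < n ] ([ A i k ] * g k)

  FirstStepAt-⇔ : ∀ {n} {A : Adj n} {g i d s} → degℚ A i ≡ d → ∑[ k < n ] ([ A i k ] * g k) ≡ s →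
    FirstStepAt A g i ⇔ (d * g i ≡ d + s)
  FirstStepAt-⇔ refl refl = mk⇔ id id

  record IsHittingTimeTo {n} (A : Adj n) (t : Fin n) (g : Fin n → ℚ) : Set where
    field
      at-target  : g t ≡ 0ℚ
      first-step : ∀ i → i ≢ t → FirstStepAt A g i

  no-neighbours : ∀ {n} (A : Adj n) i → degℚ A i ≡ 0ℚ → ∀ k → [ A i k ] ≡ 0ℚ
  no-neighbours A i d≡0 k = ≤-antisym
    (subst ([ A i k ] ≤_) (trans (sym (degℚ≡∑ A i)) d≡0) (term≤∑ ([]-nonneg ∘ A i) k))
    ([]-nonneg (A i k))

  isHittingTimeTo : ∀ {n} {A : Adj n} {h} → IsHittingTimes A h → ∀ t → IsHittingTimeTo A t (λ i → h i t)
  isHittingTimeTo {n} {A} {h} (h-diag , h-step) t = record { at-target = h-diag t ; first-step = equation }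
    where
    open ≡-Reasoning
    isolated : ∀ i → degℚ A i ≡ 0ℚ → FirstStepAt A (λ x → h x t) i
    isolated i d≡0 = begin
      degℚ A i * h i t                      ≡⟨ cong (_* h i t) d≡0 ⟩
      0ℚ * h i t                            ≡⟨ *-zeroˡ (h i t) ⟩
      0ℚ                                    ≡⟨ sym (sum-replicate-zero n) ⟩
      ∑[ k < n ] 0ℚ                         ≡⟨ sum-cong-≗ (λ k → sym (no-term k)) ⟩
      ∑[ k < n ] ([ A i k ] * h k t)        ≡⟨ sym (+-identityˡ _) ⟩
      0ℚ + ∑[ k < n ] ([ A i k ] * h k t)   ≡⟨ cong (_+ ∑[ k < n ] ([ A i k ] * h k t)) (sym d≡0) ⟩
      degℚ A i + ∑[ k < n ] ([ A i k ] * h k t) ∎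
      where
      no-term : ∀ k → [ A i k ] * h k t ≡ 0ℚ
      no-term k = trans (cong (_* h k t) (no-neighbours A i d≡0 k)) (*-zeroˡ (h k t))
    regular : ∀ i → i ≢ t → degℚ A i ≢ 0ℚ → FirstStepAt A (λ x → h x t) i
    regular i i≢t d≢0 = begin
      d * h i t
        ≡⟨ cong (d *_) (h-step i t i≢t) ⟩
      d * (1ℚ + sumℚ (λ k → ([ A i k ] * inv d) * h k t))
        ≡⟨ cong (λ s → d * (1ℚ + s)) (sumℚ≡sum (λ k → ([ A i k ] * inv d) * h k t)) ⟩
      d * (1ℚ + ∑[ k < n ] (([ A i k ] * inv d) * h k t))
        ≡⟨ *-distrib-1+ d (∑[ k < n ] (([ A i k ] * inv d) * h k t)) ⟩
      d + d * ∑[ k < n ] (([ A i k ] * inv d) * h k t)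
        ≡⟨ cong (d +_) (*-distribˡ-sum d (λ k → ([ A i k ] * inv d) * h k t)) ⟩
      d + ∑[ k < n ] (d * (([ A i k ] * inv d) * h k t))
        ≡⟨ cong (d +_) (sum-cong-≗ cancel) ⟩
      d + ∑[ k < n ] ([ A i k ] * h k t) ∎
      where
      d : ℚ
      d = degℚ A i
      *-distrib-1+ : ∀ d s → d * (1ℚ + s) ≡ d + d * s
      *-distrib-1+ = solve-∀ ℚ-ring
      regroup : ∀ d e w x → d * ((w * e) * x) ≡ (d * e) * (w * x)
      regroup = solve-∀ ℚ-ring
      cancel : ∀ k → d * (([ A i k ] * inv d) * h k t) ≡ [ A i k ] * h k t
      cancel k = trans (regroup d (inv d) [ A i k ] (h k t))
                       (trans (cong (_* ([ A i k ] * h k t)) (*-inv d d≢0)) (*-identityˡ _))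
    equation : ∀ i → i ≢ t → FirstStepAt A (λ x → h x t) i
    equation i i≢t = case degℚ A i ≟ 0ℚ of λ where
      (yes d≡0) → isolated i d≡0
      (no d≢0)  → regular i i≢t d≢0

  SuperharmonicAt : ∀ {n} → Adj n → (Fin n → ℚ) → Fin n → Set
  SuperharmonicAt {n} A f i = ∑[ k < n ] ([ A i k ] * f k) ≤ degℚ A i * f i

  min-attained : ∀ {n} (f : Fin (ℕ.suc n) → ℚ) → Σ[ x ∈ Fin (ℕ.suc n) ] (∀ y → f x ≤ f y)
  min-attained {ℕ.zero}  f = zero , λ { zero → ≤-refl }
  min-attained {ℕ.suc n} f with min-attained (f ∘ suc)
  ... | x , fx≤f with ≤-total (f zero) (f (suc x))
  ...   | inj₁ f0≤fx = zero , λ { zero → ≤-refl ; (suc y) → ≤-trans f0≤fx (fx≤f y) }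
  ...   | inj₂ fx≤f0 = suc x , λ { zero → fx≤f0 ; (suc y) → fx≤f y }

  -- At a minimum of a superharmonic function every summand [A z j] * (f j - m) is nonnegative
  -- while their sum is not positive, so each neighbour is a minimum as well.
  min-propagates : ∀ {n} {A : Adj n} {f : Fin n → ℚ} {m z k} → (∀ y → m ≤ f y) →
    SuperharmonicAt A f z → f z ≤ m → A z k ≡ true → f k ≤ m
  min-propagates {n} {A} {f} {m} {z} {k} m≤f super fz≤m z~k = p-q≤0⇒p≤q (begin
    f k - m
      ≡⟨ sym (trans (cong (_* (f k - m)) (cong [_] z~k)) (*-identityˡ _)) ⟩
    [ A z k ] * (f k - m)
      ≤⟨ term≤∑ (λ j → 0≤*0≤ ([]-nonneg (A z j)) (p≤q⇒0≤q-p (m≤f j))) k ⟩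
    ∑[ j < n ] ([ A z j ] * (f j - m))
      ≡⟨ sum-cong-≗ (λ j → expand [ A z j ] (f j) m) ⟩
    ∑[ j < n ] ([ A z j ] * f j - m * [ A z j ])
      ≡⟨ ∑-distrib-sub (λ j → [ A z j ] * f j) (λ j → m * [ A z j ]) ⟩
    ∑[ j < n ] ([ A z j ] * f j) - ∑[ j < n ] (m * [ A z j ])
      ≡⟨ cong (_-_ (∑[ j < n ] ([ A z j ] * f j))) (sym (*-distribˡ-sum m (λ j → [ A z j ]))) ⟩
    ∑[ j < n ] ([ A z j ] * f j) - m * ∑[ j < n ] [ A z j ]
      ≡⟨ cong (λ d → ∑[ j < n ] ([ A z j ] * f j) - m * d) (sym (degℚ≡∑ A z)) ⟩
    ∑[ j < n ] ([ A z j ] * f j) - m * degℚ A z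
      ≤⟨ +-monoˡ-≤ (- (m * degℚ A z)) super ⟩
    degℚ A z * f z - m * degℚ A z
      ≡⟨ factor (degℚ A z) (f z) m ⟩
    degℚ A z * (f z - m)
      ≤⟨ *-monoˡ-≤-nonNeg (degℚ A z) {{nonNegative (degℚ-nonneg A z)}} (p≤q⇒p-q≤0 fz≤m) ⟩
    degℚ A z * 0ℚ
      ≡⟨ *-zeroʳ (degℚ A z) ⟩
    0ℚ ∎)
    where
    open ≤-Reasoning
    expand : ∀ w x m → w * (x - m) ≡ w * x - m * w
    expand = solve-∀ ℚ-ring
    factor : ∀ d x m → d * x - m * d ≡ d * (x - m)
    factor = solve-∀ ℚ-ring

  minimum-principle : ∀ {n} {A : Adj n} {t} → Connected A → (f : Fin n → ℚ) →
    (∀ i → i ≢ t → SuperharmonicAt A f i) → 0ℚ ≤ f t → ∀ x → 0ℚ ≤ f x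
  minimum-principle {ℕ.suc n} {A} {t} connected f super 0≤ft x =
    ≤-trans (≤-trans 0≤ft (min-reaches (connected z t) ≤-refl)) (fz≤f x)
    where
    z : Fin (ℕ.suc n)
    z = proj₁ (min-attained f)
    fz≤f : ∀ y → f z ≤ f y
    fz≤f = proj₂ (min-attained f)
    min-reaches : ∀ {y} → Reachable A y t → f y ≤ f z → f t ≤ f z
    min-reaches here fy≤m = fy≤m
    min-reaches {y} (step y~k k↝t) fy≤m = case y ≟ᶠ t of λ where
      (yes y≡t) → subst (λ y → f y ≤ f z) y≡t fy≤m
      (no y≢t)  → min-reaches k↝t (min-propagates {A = A} {f = f} fz≤f (super y y≢t) fy≤m y~k)

  reachable⇒1≤degℚ : ∀ {n} {A : Adj n} {x t} → Reachable A x t → x ≢ t → 1ℚ ≤ degℚ A x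
  reachable⇒1≤degℚ here x≢t = ⊥-elim (x≢t refl)
  reachable⇒1≤degℚ {A = A} {x} (step {k = k} x~k _) _ =
    subst₂ _≤_ (cong [_] x~k) (sym (degℚ≡∑ A x)) (term≤∑ ([]-nonneg ∘ A x) k)

  HarmonicAt : ∀ {n} → Adj n → (Fin n → ℚ) → Fin n → Set
  HarmonicAt {n} A f i = ∑[ k < n ] ([ A i k ] * f k) ≡ degℚ A i * f i

  harmonic-vanishing : ∀ {n} {A : Adj n} {t} → Connected A → (f : Fin n → ℚ) →
    (∀ i → i ≢ t → HarmonicAt A f i) → f t ≡ 0ℚ → ∀ x → f x ≡ 0ℚ
  harmonic-vanishing {n} {A} {t} connected f harmonic ft≡0 x = ≤-antisym f≤0 0≤f
    where
    0≤f : 0ℚ ≤ f x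
    0≤f = minimum-principle connected f (λ i i≢t → ≤-reflexive (harmonic i i≢t)) (≤-reflexive (sym ft≡0)) x
    negated-harmonic : ∀ i → i ≢ t → HarmonicAt A (λ k → 0ℚ - f k) i
    negated-harmonic i i≢t = begin
      ∑[ k < n ] ([ A i k ] * (0ℚ - f k))
        ≡⟨ ∑-weighted-sub (λ k → [ A i k ]) (λ _ → 0ℚ) f ⟩
      ∑[ k < n ] ([ A i k ] * 0ℚ) - ∑[ k < n ] ([ A i k ] * f k)
        ≡⟨ cong₂ _-_ (trans (sum-cong-≗ (λ k → *-zeroʳ [ A i k ])) (sum-replicate-zero n)) (harmonic i i≢t) ⟩
      0ℚ - degℚ A i * f i
        ≡⟨ negate (degℚ A i) (f i) ⟩
      degℚ A i * (0ℚ - f i) ∎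
      where
      open ≡-Reasoning
      negate : ∀ d x → 0ℚ - d * x ≡ d * (0ℚ - x)
      negate = solve-∀ ℚ-ring
    f≤0 : f x ≤ 0ℚ
    f≤0 = 0≤q-p⇒p≤q (minimum-principle connected (λ k → 0ℚ - f k)
            (λ i i≢t → ≤-reflexive (negated-harmonic i i≢t)) (≤-reflexive (sym (cong (_-_ 0ℚ) ft≡0))) x)

  module _ {n} {A : Adj n} {t : Fin n} {g : Fin n → ℚ} (hitting : IsHittingTimeTo A t g) where
    open IsHittingTimeTo hitting

    hittingTimeTo-unique : Connected A → ∀ {g′} → IsHittingTimeTo A t g′ → ∀ x → g x ≡ g′ x
    hittingTimeTo-unique connected {g′} hitting′ x =
      p-q≡0⇒p≡q (harmonic-vanishing connected (λ k → g k - g′ k) harmonic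
                   (cong₂ _-_ at-target (IsHittingTimeTo.at-target hitting′)) x)
      where
      harmonic : ∀ i → i ≢ t → HarmonicAt A (λ k → g k - g′ k) i
      harmonic i i≢t = trans (∑-weighted-sub (λ k → [ A i k ]) g g′)
        (combine₂ (- 1ℚ) 1ℚ (certificate (degℚ A i) (g i) (g′ i) (∑[ k < n ] ([ A i k ] * g k)) (∑[ k < n ] ([ A i k ] * g′ k)))
          (first-step i i≢t) (IsHittingTimeTo.first-step hitting′ i i≢t))
        where
        certificate : ∀ d x x′ s s′ → (s - s′) - d * (x - x′) ≡ - 1ℚ * (d * x - (d + s)) + 1ℚ * (d * x′ - (d + s′))
        certificate = solve-∀ ℚ-ring

    hittingTimeTo-nonneg : Connected A → ∀ x → 0ℚ ≤ g x
    hittingTimeTo-nonneg connected = minimum-principle connected g superharmonic (≤-reflexive (sym at-target))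
      where
      superharmonic : ∀ i → i ≢ t → SuperharmonicAt A g i
      superharmonic i i≢t = subst₂ _≤_ (+-identityˡ _) (sym (first-step i i≢t))
                              (+-monoˡ-≤ (∑[ k < n ] ([ A i k ] * g k)) (degℚ-nonneg A i))

    1≤hittingTimeTo : Connected A → ∀ x → x ≢ t → 1ℚ ≤ g x
    1≤hittingTimeTo connected x x≢t = *-cancelˡ-≤-pos (degℚ A x) {{positive (<-≤-trans 0<1 1≤d)}} (begin
      degℚ A x * 1ℚ
        ≡⟨ *-identityʳ (degℚ A x) ⟩
      degℚ A x
        ≡⟨ sym (+-identityʳ (degℚ A x)) ⟩
      degℚ A x + 0ℚ
        ≤⟨ +-monoʳ-≤ (degℚ A x) (∑-nonneg (λ k → 0≤*0≤ ([]-nonneg (A x k)) (hittingTimeTo-nonneg connected k))) ⟩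
      degℚ A x + ∑[ k < n ] ([ A x k ] * g k)
        ≡⟨ sym (first-step x x≢t) ⟩
      degℚ A x * g x ∎)
      where
      open ≤-Reasoning
      0<1 : 0ℚ < 1ℚ
      0<1 = positive⁻¹ 1ℚ
      1≤d : 1ℚ ≤ degℚ A x
      1≤d = reachable⇒1≤degℚ (connected x t) x≢t

  harmonic-constant : ∀ {n} {A : Adj n} → Connected A → (f : Fin n → ℚ) →
    (∀ i → HarmonicAt A f i) → ∀ x y → f x ≡ f y
  harmonic-constant {n} {A} connected f harmonic x y =
    p-q≡0⇒p≡q (harmonic-vanishing connected (λ k → f k - f y) shifted (+-inverseʳ (f y)) x)
    where
    shifted : ∀ i → i ≢ y → HarmonicAt A (λ k → f k - f y) i
    shifted i _ = begin
      ∑[ k < n ] ([ A i k ] * (f k - f y))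
        ≡⟨ ∑-weighted-sub (λ k → [ A i k ]) f (λ _ → f y) ⟩
      ∑[ k < n ] ([ A i k ] * f k) - ∑[ k < n ] ([ A i k ] * f y)
        ≡⟨ cong₂ _-_ (harmonic i) (sym (*-distribʳ-sum (f y) (λ k → [ A i k ]))) ⟩
      degℚ A i * f i - ∑[ k < n ] [ A i k ] * f y
        ≡⟨ cong (λ d → degℚ A i * f i - d * f y) (sym (degℚ≡∑ A i)) ⟩
      degℚ A i * f i - degℚ A i * f y
        ≡⟨ factor (degℚ A i) (f i) (f y) ⟩
      degℚ A i * (f i - f y) ∎
      where
      open ≡-Reasoning
      factor : ∀ d x y → d * x - d * y ≡ d * (x - y)
      factor = solve-∀ ℚ-ring

  [≟]-refl : ∀ {n} (t : Fin n) → [ ⌊ t ≟ᶠ t ⌋ ] ≡ 1ℚ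
  [≟]-refl t = cong (λ d → [ ⌊ d ⌋ ]) (≡-≟-identity _≟ᶠ_ {x = t} refl)

  [≟]-≢ : ∀ {n} {j t : Fin n} → j ≢ t → [ ⌊ j ≟ᶠ t ⌋ ] ≡ 0ℚ
  [≟]-≢ {j = j} {t} j≢t = cong (λ d → [ ⌊ d ⌋ ]) (≢-≟-identity _≟ᶠ_ {x = j} {y = t} j≢t)

  ∑-indicator : ∀ {n} (f : Fin n → ℚ) t → ∑[ j < n ] (f j * [ ⌊ j ≟ᶠ t ⌋ ]) ≡ f t
  ∑-indicator f t = trans (∑-single (λ j → f j * [ ⌊ j ≟ᶠ t ⌋ ]) t off)
                          (trans (cong (f t *_) ([≟]-refl t)) (*-identityʳ (f t)))
    where
    off : ∀ j → j ≢ t → f j * [ ⌊ j ≟ᶠ t ⌋ ] ≡ 0ℚ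
    off j j≢t = trans (cong (f j *_) ([≟]-≢ j≢t)) (*-zeroʳ (f j))

  ∑-off-target : ∀ {n} (w f : Fin n → ℚ) t → (∀ j → 0ℚ ≤ w j) → 0ℚ ≤ f t → (∀ j → j ≢ t → 1ℚ ≤ f j) →
    ∑[ j < n ] w j - w t ≤ ∑[ j < n ] (w j * f j)
  ∑-off-target {n} w f t 0≤w 0≤ft 1≤f = begin
    ∑[ j < n ] w j - w t
      ≡⟨ cong (_-_ (∑[ j < n ] w j)) (sym (∑-indicator w t)) ⟩
    ∑[ j < n ] w j - ∑[ j < n ] (w j * [ ⌊ j ≟ᶠ t ⌋ ])
      ≡⟨ sym (∑-distrib-sub w (λ j → w j * [ ⌊ j ≟ᶠ t ⌋ ])) ⟩
    ∑[ j < n ] (w j - w j * [ ⌊ j ≟ᶠ t ⌋ ])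
      ≤⟨ ∑-mono-≤ pointwise ⟩
    ∑[ j < n ] (w j * f j) ∎
    where
    open ≤-Reasoning
    at-target : w t - w t * [ ⌊ t ≟ᶠ t ⌋ ] ≤ w t * f t
    at-target = subst (_≤ w t * f t) (sym (trans (cong (λ e → w t - w t * e) ([≟]-refl t)) (vanish (w t))))
                  (0≤*0≤ (0≤w t) 0≤ft)
      where
      vanish : ∀ x → x - x * 1ℚ ≡ 0ℚ
      vanish = solve-∀ ℚ-ring
    off-target : ∀ j → j ≢ t → w j - w j * [ ⌊ j ≟ᶠ t ⌋ ] ≤ w j * f j
    off-target j j≢t = subst (_≤ w j * f j) (sym (trans (cong (λ e → w j - w j * e) ([≟]-≢ j≢t)) (keep (w j))))
                         (subst (_≤ w j * f j) (*-identityʳ (w j)) (*-monoˡ-≤-nonNeg (w j) {{nonNegative (0≤w j)}} (1≤f j j≢t)))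
      where
      keep : ∀ x → x - x * 0ℚ ≡ x
      keep = solve-∀ ℚ-ring
    pointwise : ∀ j → w j - w j * [ ⌊ j ≟ᶠ t ⌋ ] ≤ w j * f j
    pointwise j = case j ≟ᶠ t of λ where
      (yes j≡t) → subst (λ j → w j - w j * [ ⌊ j ≟ᶠ t ⌋ ] ≤ w j * f j) (sym j≡t) at-target
      (no j≢t)  → off-target j j≢t

  -- Kac's formula: the mean return time to t is Σ d / d_t.
  kac : ∀ {n} {A : Adj n} {t g} → (∀ i j → A i j ≡ A j i) → IsHittingTimeTo A t g →
    degℚ A t + ∑[ k < n ] ([ A t k ] * g k) ≡ ∑[ i < n ] degℚ A i
  kac {n} {A} {t} {g} symmetric hitting =
    combine₂ 1ℚ (degℚ A t) (certificate (degℚ A t) (S t) (g t) (∑[ i < n ] degℚ A i) (∑[ i < n ] (degℚ A i * g i)))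
      (trans (sym ∑residual) (∑-single residual t residual-off)) at-target
    where
    open IsHittingTimeTo hitting
    open ≡-Reasoning
    S : Fin n → ℚ
    S i = ∑[ k < n ] ([ A i k ] * g k)
    residual : Fin n → ℚ
    residual i = degℚ A i * g i - (degℚ A i + S i)
    residual-off : ∀ i → i ≢ t → residual i ≡ 0ℚ
    residual-off i i≢t = trans (cong (_- (degℚ A i + S i)) (first-step i i≢t)) (+-inverseʳ (degℚ A i + S i))
    columns : ∑[ i < n ] S i ≡ ∑[ k < n ] (degℚ A k * g k)
    columns = begin
      ∑[ i < n ] ∑[ k < n ] ([ A i k ] * g k)
        ≡⟨ ∑-comm (λ i k → [ A i k ] * g k) ⟩
      ∑[ k < n ] ∑[ i < n ] ([ A i k ] * g k)
        ≡⟨ sum-cong-≗ (λ k → sym (*-distribʳ-sum (g k) (λ i → [ A i k ]))) ⟩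
      ∑[ k < n ] (∑[ i < n ] [ A i k ] * g k)
        ≡⟨ sum-cong-≗ (λ k → cong (_* g k) (trans (sum-cong-≗ (λ i → cong [_] (symmetric i k))) (sym (degℚ≡∑ A k)))) ⟩
      ∑[ k < n ] (degℚ A k * g k) ∎
    ∑residual : ∑[ i < n ] residual i ≡ ∑[ i < n ] (degℚ A i * g i) - (∑[ i < n ] degℚ A i + ∑[ i < n ] (degℚ A i * g i))
    ∑residual = trans (∑-distrib-sub (λ i → degℚ A i * g i) (λ i → degℚ A i + S i))
                      (cong (_-_ (∑[ i < n ] (degℚ A i * g i))) (trans (∑-distrib-+ (degℚ A) S) (cong (_+_ (∑[ i < n ] degℚ A i)) columns)))
    certificate : ∀ d s x D X → d + s - D ≡ 1ℚ * ((X - (D + X)) - (d * x - (d + s))) + d * (x - 0ℚ)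
    certificate = solve-∀ ℚ-ring

  kemenySum : ∀ {n} → Adj n → (Fin n → Fin n → ℚ) → Fin n → ℚ
  kemenySum {n} A h i = ∑[ j < n ] (degℚ A j * h i j)

  kemenyAt≡ : ∀ {n} (A : Adj n) h i → kemenyAt A h i ≡ inv (toℚ (2 ℕ.* numEdges A)) * kemenySum A h i
  kemenyAt≡ {n} A h i = begin
    sumℚ (λ j → (degℚ A j * c) * h i j)   ≡⟨ sumℚ≡sum (λ j → (degℚ A j * c) * h i j) ⟩
    ∑[ j < n ] ((degℚ A j * c) * h i j)    ≡⟨ sum-cong-≗ (λ j → regroup (degℚ A j) c (h i j)) ⟩
    ∑[ j < n ] (c * (degℚ A j * h i j))    ≡⟨ sym (*-distribˡ-sum c (λ j → degℚ A j * h i j)) ⟩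
    c * kemenySum A h i                    ∎
    where
    open ≡-Reasoning
    c : ℚ
    c = inv (toℚ (2 ℕ.* numEdges A))
    regroup : ∀ d c x → (d * c) * x ≡ c * (d * x)
    regroup = solve-∀ ℚ-ring

  module _ {n} {A : Adj n} {h : Fin n → Fin n → ℚ}
           (symmetric : ∀ i j → A i j ≡ A j i) (hitting : IsHittingTimes A h) where

    private
      D : ℚ
      D = ∑[ x < n ] degℚ A x

    neighbour-hitting-sum : ∀ i j → ∑[ k < n ] ([ A i k ] * h k j) ≡ degℚ A i * h i j + D * [ ⌊ j ≟ᶠ i ⌋ ] + - degℚ A i
    neighbour-hitting-sum i j = case j ≟ᶠ i of λ where
        (yes j≡i) → subst (λ j → ∑[ k < n ] ([ A i k ] * h k j) ≡ degℚ A i * h i j + D * [ ⌊ j ≟ᶠ i ⌋ ] + - degℚ A i)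
                          (sym j≡i) (return i)
        (no j≢i)  → elsewhere i j j≢i
      where
      return : ∀ i → ∑[ k < n ] ([ A i k ] * h k i) ≡ degℚ A i * h i i + D * [ ⌊ i ≟ᶠ i ⌋ ] + - degℚ A i
      return i = trans (combine₂ 1ℚ (- degℚ A i) (certificate (degℚ A i) (h i i) (∑[ k < n ] ([ A i k ] * h k i)) D)
                         (kac {A = A} symmetric (isHittingTimeTo {A = A} hitting i)) (proj₁ hitting i))
                       (cong (λ e → degℚ A i * h i i + D * e + - degℚ A i) (sym ([≟]-refl i)))
        where
        certificate : ∀ d x s D → s - (d * x + D * 1ℚ + - d) ≡ 1ℚ * (d + s - D) + - d * (x - 0ℚ)
        certificate = solve-∀ ℚ-ring
      elsewhere : ∀ i j → j ≢ i → ∑[ k < n ] ([ A i k ] * h k j) ≡ degℚ A i * h i j + D * [ ⌊ j ≟ᶠ i ⌋ ] + - degℚ A i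
      elsewhere i j j≢i = trans (combine₁ (- 1ℚ) (certificate (degℚ A i) (h i j) (∑[ k < n ] ([ A i k ] * h k j)) D)
                                  (IsHittingTimeTo.first-step (isHittingTimeTo {A = A} hitting j) i (j≢i ∘ sym)))
                                (cong (λ e → degℚ A i * h i j + D * e + - degℚ A i) (sym ([≟]-≢ j≢i)))
        where
        certificate : ∀ d x s D → s - (d * x + D * 0ℚ + - d) ≡ - 1ℚ * (d * x - (d + s))
        certificate = solve-∀ ℚ-ring

    kemenySum-harmonic : ∀ i → HarmonicAt A (kemenySum A h) i
    kemenySum-harmonic i = begin
      ∑[ k < n ] ([ A i k ] * ∑[ j < n ] (degℚ A j * h k j))
        ≡⟨ sum-cong-≗ (λ k → *-distribˡ-sum [ A i k ] (λ j → degℚ A j * h k j)) ⟩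
      ∑[ k < n ] ∑[ j < n ] ([ A i k ] * (degℚ A j * h k j))
        ≡⟨ ∑-comm (λ k j → [ A i k ] * (degℚ A j * h k j)) ⟩
      ∑[ j < n ] ∑[ k < n ] ([ A i k ] * (degℚ A j * h k j))
        ≡⟨ sum-cong-≗ (λ j → pull j) ⟩
      ∑[ j < n ] (degℚ A j * ∑[ k < n ] ([ A i k ] * h k j))
        ≡⟨ sum-cong-≗ (λ j → cong (degℚ A j *_) (neighbour-hitting-sum i j)) ⟩
      ∑[ j < n ] (degℚ A j * (degℚ A i * h i j + D * [ ⌊ j ≟ᶠ i ⌋ ] + - degℚ A i))
          ≡⟨ ∑-linear (degℚ A) (h i) (λ j → [ ⌊ j ≟ᶠ i ⌋ ]) (degℚ A i) D (- degℚ A i) ⟩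
      degℚ A i * kemenySum A h i + D * ∑[ j < n ] (degℚ A j * [ ⌊ j ≟ᶠ i ⌋ ]) + - degℚ A i * D
          ≡⟨ cong (λ x → degℚ A i * kemenySum A h i + D * x + - degℚ A i * D) (∑-indicator (degℚ A) i) ⟩
      degℚ A i * kemenySum A h i + D * degℚ A i + - degℚ A i * D
        ≡⟨ cancel (degℚ A i * kemenySum A h i) D (degℚ A i) ⟩
      degℚ A i * kemenySum A h i ∎
      where
      open ≡-Reasoning
      pull : ∀ j → ∑[ k < n ] ([ A i k ] * (degℚ A j * h k j)) ≡ degℚ A j * ∑[ k < n ] ([ A i k ] * h k j)
      pull j = trans (sum-cong-≗ (λ k → swap [ A i k ] (degℚ A j) (h k j))) (sym (*-distribˡ-sum (degℚ A j) (λ k → [ A i k ] * h k j)))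
        where
        swap : ∀ w d x → w * (d * x) ≡ d * (w * x)
        swap = solve-∀ ℚ-ring
      cancel : ∀ F D d → F + D * d + - d * D ≡ F
      cancel = solve-∀ ℚ-ring

  kemenyAt-independent : ∀ {n} {A : Adj n} {h} → IsSimple A → Connected A → IsHittingTimes A h →
    ∀ i j → kemenyAt A h i ≡ kemenyAt A h j
  kemenyAt-independent {A = A} {h} (symmetric , _) connected hitting i j = begin
    kemenyAt A h i                                          ≡⟨ kemenyAt≡ A h i ⟩
    inv (toℚ (2 ℕ.* numEdges A)) * kemenySum A h i          ≡⟨ cong (inv (toℚ (2 ℕ.* numEdges A)) *_) constant ⟩
    inv (toℚ (2 ℕ.* numEdges A)) * kemenySum A h j          ≡⟨ sym (kemenyAt≡ A h j) ⟩
    kemenyAt A h j ∎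
    where
    open ≡-Reasoning
    constant : kemenySum A h i ≡ kemenySum A h j
    constant = harmonic-constant connected (kemenySum A h) (kemenySum-harmonic symmetric hitting) i j

  -- Attaching a three-vertex gadget at v

  old : ∀ {n} → Fin n → Fin (3 ℕ.+ n)
  old i = 3 ↑ʳ i

  new : ∀ {n} → Fin 3 → Fin (3 ℕ.+ n)
  new {n} x = x ↑ˡ n

  data Vertex {n} : Fin (3 ℕ.+ n) → Set where
    is-new : ∀ x → Vertex (new x)
    is-old : ∀ i → Vertex (old i)

  vertex : ∀ {n} (x : Fin (3 ℕ.+ n)) → Vertex x
  vertex zero                = is-new zero
  vertex (suc zero)          = is-new (suc zero)
  vertex (suc (suc zero))    = is-new (suc (suc zero))
  vertex (suc (suc (suc i))) = is-old i

  old≢new : ∀ {n} (i : Fin n) x → old i ≢ new x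
  old≢new i zero             ()
  old≢new i (suc zero)       ()
  old≢new i (suc (suc zero)) ()

  old-injective : ∀ {n} {i j : Fin n} → old i ≡ old j → i ≡ j
  old-injective refl = refl

  record IsGluedAt {n} (A : Adj n) (v : Fin n) (B : Adj (3 ℕ.+ n)) : Set where
    field
      old-old : ∀ i j → B (old i) (old j) ≡ A i j
      old-new : ∀ i x → B (old i) (new x) ≡ ⌊ i ≟ᶠ v ⌋
      new-old : ∀ x j → B (new x) (old j) ≡ ⌊ j ≟ᶠ v ⌋

  gadget : ∀ {n} → Adj (3 ℕ.+ n) → Adj 3
  gadget B x y = B (new x) (new y)

  barAdj-gluedAt : ∀ {n} (A : Adj n) v → IsGluedAt A v (barAdj A v)
  barAdj-gluedAt A v = record { old-old = λ i j → refl ; old-new = old-new ; new-old = new-old }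
    where
    old-new : ∀ i x → barAdj A v (old i) (new x) ≡ ⌊ i ≟ᶠ v ⌋
    old-new i zero             = refl
    old-new i (suc zero)       = refl
    old-new i (suc (suc zero)) = refl
    new-old : ∀ x j → barAdj A v (new x) (old j) ≡ ⌊ j ≟ᶠ v ⌋
    new-old zero             j = refl
    new-old (suc zero)       j = refl
    new-old (suc (suc zero)) j = refl

  addEdge-away : ∀ {n} (B : Adj n) x y i j → ¬ (i ≡ x × j ≡ y) → ¬ (i ≡ y × j ≡ x) → addEdge B x y i j ≡ B i j
  addEdge-away B x y i j ¬xy ¬yx with i ≟ᶠ x | j ≟ᶠ y | i ≟ᶠ y | j ≟ᶠ x
  ... | yes i≡x | yes j≡y | _       | _       = ⊥-elim (¬xy (i≡x , j≡y))
  ... | _       | _       | yes i≡y | yes j≡x = ⊥-elim (¬yx (i≡y , j≡x))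
  ... | yes _   | no _    | yes _   | no _    = ∨-identityʳ (B i j)
  ... | yes _   | no _    | no _    | _       = ∨-identityʳ (B i j)
  ... | no _    | _       | yes _   | no _    = ∨-identityʳ (B i j)
  ... | no _    | _       | no _    | _       = ∨-identityʳ (B i j)

  addEdge-gluedAt : ∀ {n} {A : Adj n} {v B} → IsGluedAt A v B → ∀ x y → IsGluedAt A v (addEdge B (new x) (new y))
  addEdge-gluedAt {B = B} glued x y = record
    { old-old = λ i j → trans (addEdge-away B _ _ (old i) (old j) (old≢new i x ∘ proj₁) (old≢new i y ∘ proj₁)) (old-old i j)
    ; old-new = λ i z → trans (addEdge-away B _ _ (old i) (new z) (old≢new i x ∘ proj₁) (old≢new i y ∘ proj₁)) (old-new i z)
    ; new-old = λ z j → trans (addEdge-away B _ _ (new z) (old j) (old≢new j y ∘ proj₂) (old≢new j x ∘ proj₂)) (new-old z j)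
    }
    where open IsGluedAt glued

  isSimple? : ∀ {n} (E : Adj n) → Dec (IsSimple E)
  isSimple? E = all? (λ i → all? (λ j → E i j Bool.≟ E j i)) ×-dec all? (λ i → E i i Bool.≟ false)

  gluedAt-isSimple : ∀ {n} {A : Adj n} {v B} → IsGluedAt A v B → IsSimple A → IsSimple (gadget B) → IsSimple B
  gluedAt-isSimple {A = A} {B = B} glued (A-symmetric , A-loopless) (E-symmetric , E-loopless) = symmetric , loopless
    where
    open IsGluedAt glued
    symmetric : ∀ x y → B x y ≡ B y x
    symmetric x y with vertex x | vertex y
    ... | is-new p | is-new q = E-symmetric p q
    ... | is-new p | is-old j = trans (new-old p j) (sym (old-new j p))
    ... | is-old i | is-new q = trans (old-new i q) (sym (new-old q i))
    ... | is-old i | is-old j = trans (old-old i j) (trans (A-symmetric i j) (sym (old-old j i)))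
    loopless : ∀ x → B x x ≡ false
    loopless x with vertex x
    ... | is-new p = E-loopless p
    ... | is-old i = trans (old-old i i) (A-loopless i)

  Reachable-trans : ∀ {n} {A : Adj n} {x y z} → Reachable A x y → Reachable A y z → Reachable A x z
  Reachable-trans here            y↝z = y↝z
  Reachable-trans (step x~k k↝y) y↝z = step x~k (Reachable-trans k↝y y↝z)

  gluedAt-connected : ∀ {n} {A : Adj n} {v B} → IsGluedAt A v B → Connected A → Connected B
  gluedAt-connected {n} {A} {v} {B} glued connected x y = Reachable-trans (to-hub x) (from-hub y)
    where
    open IsGluedAt glued
    v~v : ⌊ v ≟ᶠ v ⌋ ≡ true
    v~v = cong ⌊_⌋ (≡-≟-identity _≟ᶠ_ {x = v} refl)
    lift : ∀ {i j} → Reachable A i j → Reachable B (old i) (old j)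
    lift here                        = here
    lift (step {i} {k} i~k k↝j) = step (trans (old-old i k) i~k) (lift k↝j)
    to-hub : ∀ x → Reachable B x (old v)
    to-hub x with vertex x
    ... | is-new p = step (trans (new-old p v) v~v) here
    ... | is-old i = lift (connected i v)
    from-hub : ∀ y → Reachable B (old v) y
    from-hub y with vertex y
    ... | is-new q = step (trans (old-new v q) v~v) here
    ... | is-old j = lift (connected v j)

  module GluedAt {n} {A : Adj n} {v : Fin n} {B : Adj (3 ℕ.+ n)} (glued : IsGluedAt A v B) where
    open IsGluedAt glued
    open ≡-Reasoning

    hub : Fin (3 ℕ.+ n)
    hub = old v

    new-row : ∀ x (g : Fin (3 ℕ.+ n) → ℚ) →
      ∑[ k < 3 ℕ.+ n ] ([ B (new x) k ] * g k) ≡ ∑[ y < 3 ] ([ B (new x) (new y) ] * g (new y)) + g hub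
    new-row x g = trans (cong (λ s → w va * g va + (w vb * g vb + (w vc * g vc + s)))
                              (trans (sum-cong-≗ to-hub) (∑-indicator (g ∘ old) v)))
                        (regroup (w va * g va) (w vb * g vb) (w vc * g vc) (g hub))
      where
      w : Fin (3 ℕ.+ n) → ℚ
      w k = [ B (new x) k ]
      to-hub : ∀ j → [ B (new x) (old j) ] * g (old j) ≡ g (old j) * [ ⌊ j ≟ᶠ v ⌋ ]
      to-hub j = trans (cong (λ e → [ e ] * g (old j)) (new-old x j)) (*-comm _ (g (old j)))
      regroup : ∀ p q r s → p + (q + (r + s)) ≡ p + (q + (r + 0ℚ)) + s
      regroup = solve-∀ ℚ-ring

    old-row : ∀ i (g : Fin (3 ℕ.+ n) → ℚ) →
      ∑[ k < 3 ℕ.+ n ] ([ B (old i) k ] * g k) ≡ [ ⌊ i ≟ᶠ v ⌋ ] * (g va + g vb + g vc) + ∑[ j < n ] ([ A i j ] * g (old j))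
    old-row i g = trans (cong₂ _+_ (entry zero) (cong₂ _+_ (entry (suc zero)) (cong₂ _+_ (entry (suc (suc zero)))
                          (sum-cong-≗ (λ j → cong (λ e → [ e ] * g (old j)) (old-old i j))))))
                        (factor [ ⌊ i ≟ᶠ v ⌋ ] (g va) (g vb) (g vc) (∑[ j < n ] ([ A i j ] * g (old j))))
      where
      entry : ∀ x → [ B (old i) (new x) ] * g (new x) ≡ [ ⌊ i ≟ᶠ v ⌋ ] * g (new x)
      entry x = cong (λ e → [ e ] * g (new x)) (old-new i x)
      factor : ∀ e p q r s → e * p + (e * q + (e * r + s)) ≡ e * (p + q + r) + s
      factor = solve-∀ ℚ-ring

    hub-row : ∀ (g : Fin (3 ℕ.+ n) → ℚ) →
      ∑[ k < 3 ℕ.+ n ] ([ B hub k ] * g k) ≡ (g va + g vb + g vc) + ∑[ j < n ] ([ A v j ] * g (old j))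
    hub-row g = trans (old-row v g) (cong (_+ ∑[ j < n ] ([ A v j ] * g (old j))) one-times)
      where
      one-times : [ ⌊ v ≟ᶠ v ⌋ ] * (g va + g vb + g vc) ≡ g va + g vb + g vc
      one-times = trans (cong (_* (g va + g vb + g vc)) ([≟]-refl v)) (*-identityˡ (g va + g vb + g vc))

    other-row : ∀ {i} → i ≢ v → ∀ (g : Fin (3 ℕ.+ n) → ℚ) →
      ∑[ k < 3 ℕ.+ n ] ([ B (old i) k ] * g k) ≡ ∑[ j < n ] ([ A i j ] * g (old j))
    other-row {i} i≢v g = trans (old-row i g) (trans (cong (_+ ∑[ j < n ] ([ A i j ] * g (old j))) zero-times)
                                                   (+-identityˡ (∑[ j < n ] ([ A i j ] * g (old j)))))
      where
      zero-times : [ ⌊ i ≟ᶠ v ⌋ ] * (g va + g vb + g vc) ≡ 0ℚ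
      zero-times = trans (cong (_* (g va + g vb + g vc)) ([≟]-≢ i≢v)) (*-zeroˡ (g va + g vb + g vc))

    private
      ∑-times-1 : ∀ {m} (w : Fin m → ℚ) → ∑[ k < m ] (w k * 1ℚ) ≡ ∑[ k < m ] w k
      ∑-times-1 w = sum-cong-≗ (λ k → *-identityʳ (w k))

    new-deg : ∀ x → degℚ B (new x) ≡ ∑[ y < 3 ] [ B (new x) (new y) ] + 1ℚ
    new-deg x = begin
      degℚ B (new x)
        ≡⟨ degℚ≡∑ B (new x) ⟩
      ∑[ k < 3 ℕ.+ n ] [ B (new x) k ]
        ≡⟨ sym (∑-times-1 (λ k → [ B (new x) k ])) ⟩
      ∑[ k < 3 ℕ.+ n ] ([ B (new x) k ] * 1ℚ)
        ≡⟨ new-row x (λ _ → 1ℚ) ⟩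
      ∑[ y < 3 ] ([ B (new x) (new y) ] * 1ℚ) + 1ℚ
        ≡⟨ cong (_+ 1ℚ) (∑-times-1 (λ y → [ B (new x) (new y) ])) ⟩
      ∑[ y < 3 ] [ B (new x) (new y) ] + 1ℚ ∎

    hub-deg : degℚ B hub ≡ 3 + degℚ A v
    hub-deg = begin
      degℚ B hub
        ≡⟨ degℚ≡∑ B hub ⟩
      ∑[ k < 3 ℕ.+ n ] [ B hub k ]
        ≡⟨ sym (∑-times-1 (λ k → [ B hub k ])) ⟩
      ∑[ k < 3 ℕ.+ n ] ([ B hub k ] * 1ℚ)
        ≡⟨ hub-row (λ _ → 1ℚ) ⟩
      3 + ∑[ j < n ] ([ A v j ] * 1ℚ)
        ≡⟨ cong (3 +_) (trans (∑-times-1 (λ j → [ A v j ])) (sym (degℚ≡∑ A v))) ⟩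
      3 + degℚ A v ∎

    other-deg : ∀ {i} → i ≢ v → degℚ B (old i) ≡ degℚ A i
    other-deg {i} i≢v = begin
      degℚ B (old i)
        ≡⟨ degℚ≡∑ B (old i) ⟩
      ∑[ k < 3 ℕ.+ n ] [ B (old i) k ]
        ≡⟨ sym (∑-times-1 (λ k → [ B (old i) k ])) ⟩
      ∑[ k < 3 ℕ.+ n ] ([ B (old i) k ] * 1ℚ)
        ≡⟨ other-row i≢v (λ _ → 1ℚ) ⟩
      ∑[ j < n ] ([ A i j ] * 1ℚ)
        ≡⟨ trans (∑-times-1 (λ j → [ A i j ])) (sym (degℚ≡∑ A i)) ⟩
      degℚ A i ∎

    old-deg : ∀ i → degℚ B (old i) ≡ 3 * [ ⌊ i ≟ᶠ v ⌋ ] + degℚ A i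
    old-deg i = begin
      degℚ B (old i)
        ≡⟨ degℚ≡∑ B (old i) ⟩
      ∑[ k < 3 ℕ.+ n ] [ B (old i) k ]
        ≡⟨ sym (∑-times-1 (λ k → [ B (old i) k ])) ⟩
      ∑[ k < 3 ℕ.+ n ] ([ B (old i) k ] * 1ℚ)
        ≡⟨ old-row i (λ _ → 1ℚ) ⟩
      [ ⌊ i ≟ᶠ v ⌋ ] * 3 + ∑[ j < n ] ([ A i j ] * 1ℚ)
        ≡⟨ cong₂ _+_ (*-comm [ ⌊ i ≟ᶠ v ⌋ ] 3) (trans (∑-times-1 (λ j → [ A i j ])) (sym (degℚ≡∑ A i))) ⟩
      3 * [ ⌊ i ≟ᶠ v ⌋ ] + degℚ A i ∎

    ∑-old-deg : ∑[ i < n ] degℚ B (old i) ≡ 3 + ∑[ i < n ] degℚ A i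
    ∑-old-deg = begin
      ∑[ i < n ] degℚ B (old i)
        ≡⟨ sum-cong-≗ old-deg ⟩
      ∑[ i < n ] (3 * [ ⌊ i ≟ᶠ v ⌋ ] + degℚ A i)
        ≡⟨ ∑-distrib-+ (λ i → 3 * [ ⌊ i ≟ᶠ v ⌋ ]) (degℚ A) ⟩
      ∑[ i < n ] (3 * [ ⌊ i ≟ᶠ v ⌋ ]) + ∑[ i < n ] degℚ A i
        ≡⟨ cong (_+ ∑[ i < n ] degℚ A i) (∑-indicator (λ _ → 3) v) ⟩
      3 + ∑[ i < n ] degℚ A i ∎

    hub-first-step : ∀ g → FirstStepAt B g hub ⇔
      ((3 + degℚ A v) * g hub ≡ (3 + degℚ A v) + ((g va + g vb + g vc) + ∑[ j < n ] ([ A v j ] * g (old j))))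
    hub-first-step g = FirstStepAt-⇔ {A = B} {g = g} hub-deg (hub-row g)

    other-first-step : ∀ {i} → i ≢ v → ∀ g → FirstStepAt B g (old i) ⇔ FirstStepAt A (g ∘ old) i
    other-first-step i≢v g = FirstStepAt-⇔ {A = B} {g = g} (other-deg i≢v) (other-row i≢v g)

    hittingTimeTo-old : ∀ {j} {f : Fin (3 ℕ.+ n) → ℚ} → f (old j) ≡ 0ℚ →
      (∀ x → FirstStepAt B f (new x)) →
      (j ≢ v → (3 + degℚ A v) * f hub ≡ (3 + degℚ A v) + ((f va + f vb + f vc) + ∑[ k < n ] ([ A v k ] * f (old k)))) →
      (∀ i → i ≢ v → i ≢ j → FirstStepAt A (f ∘ old) i) →
      IsHittingTimeTo B (old j) f
    hittingTimeTo-old {j} {f} at-target new-step hub-step other-step = record { at-target = at-target ; first-step = equation }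
      where
      equation : ∀ x → x ≢ old j → FirstStepAt B f x
      equation zero                _   = new-step zero
      equation (suc zero)          _   = new-step (suc zero)
      equation (suc (suc zero))    _   = new-step (suc (suc zero))
      equation (suc (suc (suc i))) x≢t = case i ≟ᶠ v of λ where
        (yes i≡v) → subst (λ i → FirstStepAt B f (old i)) (sym i≡v)
                          (Equivalence.from (hub-first-step f) (hub-step (λ j≡v → x≢t (cong old (trans i≡v (sym j≡v))))))
        (no i≢v)  → Equivalence.from (other-first-step i≢v f) (other-step i i≢v (x≢t ∘ cong old))

  -- x, y, z (or p, q, r) are the values at a, b, c, h or x the value at the hub, s the value at
  -- the target; Kac's formula replaces the first-step equation at a target inside the gadget.

  path-escape : ∀ {x y z h : ℚ} →
    2 * x ≡ 2 + (y + h) → 3 * y ≡ 3 + (x + z + h) → 2 * z ≡ 2 + (y + h) →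
    x ≡ h + 9 / 4 × y ≡ h + 5 / 2 × z ≡ h + 9 / 4
  path-escape {x} {y} {z} {h} eqa eqb eqc =
      combine₃ (5 / 8) (1 / 4) (1 / 8) (certificate-a x y z h) eqa eqb eqc
    , combine₃ (1 / 4) (1 / 2) (1 / 4) (certificate-b x y z h) eqa eqb eqc
    , combine₃ (1 / 8) (1 / 4) (5 / 8) (certificate-c x y z h) eqa eqb eqc
    where
    certificate-a : ∀ x y z h → x - (h + 9 / 4)
      ≡ 5 / 8 * (2 * x - (2 + (y + h))) + 1 / 4 * (3 * y - (3 + (x + z + h))) + 1 / 8 * (2 * z - (2 + (y + h)))
    certificate-a = solve-∀ ℚ-ring
    certificate-b : ∀ x y z h → y - (h + 5 / 2)
      ≡ 1 / 4 * (2 * x - (2 + (y + h))) + 1 / 2 * (3 * y - (3 + (x + z + h))) + 1 / 4 * (2 * z - (2 + (y + h)))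
    certificate-b = solve-∀ ℚ-ring
    certificate-c : ∀ x y z h → z - (h + 9 / 4)
      ≡ 1 / 8 * (2 * x - (2 + (y + h))) + 1 / 4 * (3 * y - (3 + (x + z + h))) + 5 / 8 * (2 * z - (2 + (y + h)))
    certificate-c = solve-∀ ℚ-ring

  path-end-target : ∀ {s y z x μ : ℚ} → s ≡ 0ℚ →
    2 + (y + x) ≡ 10 + 2 * μ → 3 * y ≡ 3 + (s + z + x) → 2 * z ≡ 2 + (y + x) → x ≡ 5 / 4 * μ + 4
  path-end-target {y = y} {z} {x} {μ} refl kac-eq eqy eqz =
    combine₃ (5 / 8) (- (1 / 4)) (- (1 / 8)) (certificate y z x μ) kac-eq eqy eqz
    where
    certificate : ∀ y z x μ → x - (5 / 4 * μ + 4)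
      ≡ 5 / 8 * (2 + (y + x) - (10 + 2 * μ)) + - (1 / 4) * (3 * y - (3 + (0ℚ + z + x))) + - (1 / 8) * (2 * z - (2 + (y + x)))
    certificate = solve-∀ ℚ-ring

  path-middle-target : ∀ {s p r x μ : ℚ} → s ≡ 0ℚ →
    3 + (p + r + x) ≡ 10 + 2 * μ → 2 * p ≡ 2 + (s + x) → 2 * r ≡ 2 + (s + x) → x ≡ μ + 5 / 2
  path-middle-target {p = p} {r} {x} {μ} refl kac-eq eqp eqr =
    combine₃ (1 / 2) (- (1 / 4)) (- (1 / 4)) (certificate p r x μ) kac-eq eqp eqr
    where
    certificate : ∀ p r x μ → x - (μ + 5 / 2)
      ≡ 1 / 2 * (3 + (p + r + x) - (10 + 2 * μ)) + - (1 / 4) * (2 * p - (2 + (0ℚ + x))) + - (1 / 4) * (2 * r - (2 + (0ℚ + x)))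
    certificate = solve-∀ ℚ-ring

  triangle-target : ∀ {s q r x μ : ℚ} → s ≡ 0ℚ →
    3 + (q + r + x) ≡ 12 + 2 * μ → 3 * q ≡ 3 + (r + s + x) → 3 * r ≡ 3 + (s + q + x) → x ≡ μ + 3
  triangle-target {q = q} {r} {x} {μ} refl kac-eq eqq eqr =
    combine₃ (1 / 2) (- (1 / 4)) (- (1 / 4)) (certificate q r x μ) kac-eq eqq eqr
    where
    certificate : ∀ q r x μ → x - (μ + 3)
      ≡ 1 / 2 * (3 + (q + r + x) - (12 + 2 * μ)) + - (1 / 4) * (3 * q - (3 + (r + 0ℚ + x))) + - (1 / 4) * (3 * r - (3 + (0ℚ + q + x)))
    certificate = solve-∀ ℚ-ring

  -- Hitting times in Ĝ

  module Hat {n} {A : Adj n} {v : Fin n} (simple : IsSimple A) (connected : Connected A)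
             {h : Fin (3 ℕ.+ n) → Fin (3 ℕ.+ n) → ℚ} (hitting : IsHittingTimes (hatAdj A v) h) where

    Ĥ : Adj (3 ℕ.+ n)
    Ĥ = hatAdj A v

    glued : IsGluedAt A v Ĥ
    glued = addEdge-gluedAt (addEdge-gluedAt (barAdj-gluedAt A v) zero (suc zero)) (suc zero) (suc (suc zero))

    open GluedAt glued public

    Ĥ-simple : IsSimple Ĥ
    Ĥ-simple = gluedAt-isSimple glued simple (from-yes (isSimple? (gadget Ĥ)))

    Ĥ-connected : Connected Ĥ
    Ĥ-connected = gluedAt-connected glued connected

    μ : ℚ
    μ = toℚ (numEdges A)

    ∑deg : ∑[ x < 3 ℕ.+ n ] degℚ Ĥ x ≡ 10 + 2 * μ
    ∑deg = trans (cong₂ _+_ (new-deg zero) (cong₂ _+_ (new-deg (suc zero)) (cong₂ _+_ (new-deg (suc (suc zero)))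
                   (trans ∑-old-deg (cong (3 +_) (handshake simple))))))
                 (tally μ)
      where
      tally : ∀ μ → 2 + (3 + (2 + (3 + 2 * μ))) ≡ 10 + 2 * μ
      tally = solve-∀ ℚ-ring

    hitting-to : ∀ t → IsHittingTimeTo Ĥ t (λ x → h x t)
    hitting-to = isHittingTimeTo hitting

    row-a : ∀ g → ∑[ k < 3 ℕ.+ n ] ([ Ĥ va k ] * g k) ≡ g vb + g hub
    row-a g = trans (new-row zero g) (tidy (g va) (g vb) (g vc) (g hub))
      where
      tidy : ∀ p q r s → [ false ] * p + ([ true ] * q + ([ false ] * r + 0ℚ)) + s ≡ q + s
      tidy = solve-∀ ℚ-ring

    row-b : ∀ g → ∑[ k < 3 ℕ.+ n ] ([ Ĥ vb k ] * g k) ≡ g va + g vc + g hub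
    row-b g = trans (new-row (suc zero) g) (tidy (g va) (g vb) (g vc) (g hub))
      where
      tidy : ∀ p q r s → [ true ] * p + ([ false ] * q + ([ true ] * r + 0ℚ)) + s ≡ p + r + s
      tidy = solve-∀ ℚ-ring

    row-c : ∀ g → ∑[ k < 3 ℕ.+ n ] ([ Ĥ vc k ] * g k) ≡ g vb + g hub
    row-c g = trans (new-row (suc (suc zero)) g) (tidy (g va) (g vb) (g vc) (g hub))
      where
      tidy : ∀ p q r s → [ false ] * p + ([ true ] * q + ([ false ] * r + 0ℚ)) + s ≡ q + s
      tidy = solve-∀ ℚ-ring

    step-a : ∀ {t} → va ≢ t → 2 * h va t ≡ 2 + (h vb t + h hub t)
    step-a {t} a≢t =
      Equivalence.to (FirstStepAt-⇔ {A = Ĥ} {g = λ x → h x t} {i = va} (new-deg zero) (row-a (λ x → h x t)))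
                     (IsHittingTimeTo.first-step (hitting-to t) va a≢t)

    step-b : ∀ {t} → vb ≢ t → 3 * h vb t ≡ 3 + (h va t + h vc t + h hub t)
    step-b {t} b≢t =
      Equivalence.to (FirstStepAt-⇔ {A = Ĥ} {g = λ x → h x t} {i = vb} (new-deg (suc zero)) (row-b (λ x → h x t)))
                     (IsHittingTimeTo.first-step (hitting-to t) vb b≢t)

    step-c : ∀ {t} → vc ≢ t → 2 * h vc t ≡ 2 + (h vb t + h hub t)
    step-c {t} c≢t =
      Equivalence.to (FirstStepAt-⇔ {A = Ĥ} {g = λ x → h x t} {i = vc} (new-deg (suc (suc zero))) (row-c (λ x → h x t)))
                     (IsHittingTimeTo.first-step (hitting-to t) vc c≢t)

    escape : ∀ j → h va (old j) ≡ h hub (old j) + 9 / 4 × h vb (old j) ≡ h hub (old j) + 5 / 2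
                     × h vc (old j) ≡ h hub (old j) + 9 / 4
    escape j = path-escape (step-a λ ()) (step-b λ ()) (step-c λ ())

    gadget-to-hub : h va hub + h vb hub + h vc hub ≡ 7
    gadget-to-hub = combine₄ 1ℚ 1ℚ 1ℚ 3 (certificate (h va hub) (h vb hub) (h vc hub) (h hub hub))
                      (proj₁ (escape v)) (proj₁ (proj₂ (escape v))) (proj₂ (proj₂ (escape v)))
                      (IsHittingTimeTo.at-target (hitting-to hub))
      where
      certificate : ∀ a b c z → a + b + c - 7
        ≡ 1ℚ * (a - (z + 9 / 4)) + 1ℚ * (b - (z + 5 / 2)) + 1ℚ * (c - (z + 9 / 4)) + 3 * (z - 0ℚ)
      certificate = solve-∀ ℚ-ring

    return-to-hub : ∑[ j < n ] ([ A v j ] * h (old j) hub) ≡ 2 * μ - degℚ A v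
    return-to-hub =
      combine₂ 1ℚ (- 1ℚ) (certificate (degℚ A v) (h va hub + h vb hub + h vc hub) K μ) kac-hub gadget-to-hub
      where
      K : ℚ
      K = ∑[ j < n ] ([ A v j ] * h (old j) hub)
      kac-hub : 3 + degℚ A v + ((h va hub + h vb hub + h vc hub) + K) ≡ 10 + 2 * μ
      kac-hub = trans (sym (cong₂ _+_ hub-deg (hub-row (λ x → h x hub)))) (trans (kac (proj₁ Ĥ-simple) (hitting-to hub)) ∑deg)
      certificate : ∀ d G K μ → K - (2 * μ - d) ≡ 1ℚ * (3 + d + (G + K) - (10 + 2 * μ)) + - 1ℚ * (G - 7)
      certificate = solve-∀ ℚ-ring

    hub-to-a : h hub va ≡ 5 / 4 * μ + 4
    hub-to-a = path-end-target {y = h vb va} {h vc va} {h hub va} {μ}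
                 (IsHittingTimeTo.at-target (hitting-to va)) kac-a (step-b λ ()) (step-c λ ())
      where
      kac-a : 2 + (h vb va + h hub va) ≡ 10 + 2 * μ
      kac-a = trans (sym (cong₂ _+_ (new-deg zero) (row-a (λ x → h x va)))) (trans (kac (proj₁ Ĥ-simple) (hitting-to va)) ∑deg)

    hub-to-b : h hub vb ≡ μ + 5 / 2
    hub-to-b = path-middle-target {p = h va vb} {h vc vb} {h hub vb} {μ}
                 (IsHittingTimeTo.at-target (hitting-to vb)) kac-b (step-a λ ()) (step-c λ ())
      where
      kac-b : 3 + (h va vb + h vc vb + h hub vb) ≡ 10 + 2 * μ
      kac-b = trans (sym (cong₂ _+_ (new-deg (suc zero)) (row-b (λ x → h x vb)))) (trans (kac (proj₁ Ĥ-simple) (hitting-to vb)) ∑deg)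

    hub-to-c : h hub vc ≡ 5 / 4 * μ + 4
    hub-to-c = path-end-target {y = h vb vc} {h va vc} {h hub vc} {μ}
                 (IsHittingTimeTo.at-target (hitting-to vc)) kac-c
                 (trans (step-b λ ()) (cong (λ u → 3 + (u + h hub vc)) (+-comm (h va vc) (h vc vc)))) (step-a λ ())
      where
      kac-c : 2 + (h vb vc + h hub vc) ≡ 10 + 2 * μ
      kac-c = trans (sym (cong₂ _+_ (new-deg (suc (suc zero))) (row-c (λ x → h x vc)))) (trans (kac (proj₁ Ĥ-simple) (hitting-to vc)) ∑deg)

    hub-step : ∀ {j} → j ≢ v →
      degℚ A v * h hub (old j) ≡ degℚ A v + 10 + ∑[ k < n ] ([ A v k ] * h (old k) (old j))
    hub-step {j} j≢v = combine₄ 1ℚ 1ℚ 1ℚ 1ℚ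
      (certificate (degℚ A v) (h hub (old j)) (∑[ k < n ] ([ A v k ] * h (old k) (old j))) (h va (old j)) (h vb (old j)) (h vc (old j)))
      (Equivalence.to (hub-first-step (λ x → h x (old j)))
                      (IsHittingTimeTo.first-step (hitting-to (old j)) hub (j≢v ∘ sym ∘ old-injective)))
      (proj₁ (escape j)) (proj₁ (proj₂ (escape j))) (proj₂ (proj₂ (escape j)))
      where
      certificate : ∀ d H S a b c → d * H - (d + 10 + S)
        ≡ 1ℚ * ((3 + d) * H - (3 + d + ((a + b + c) + S))) + 1ℚ * (a - (H + 9 / 4)) + 1ℚ * (b - (H + 5 / 2)) + 1ℚ * (c - (H + 9 / 4))
      certificate = solve-∀ ℚ-ring

    other-step : ∀ {i t} → i ≢ v → old i ≢ t → FirstStepAt A (λ k → h (old k) t) i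
    other-step {i} {t} i≢v i≢t =
      Equivalence.to (other-first-step i≢v (λ x → h x t)) (IsHittingTimeTo.first-step (hitting-to t) (old i) i≢t)

    1≤to-hub : ∀ j → j ≢ v → 1ℚ ≤ h (old j) hub
    1≤to-hub j j≢v = 1≤hittingTimeTo (hitting-to hub) Ĥ-connected (old j) (j≢v ∘ old-injective)

    0≤hub-hub : 0ℚ ≤ h hub hub
    0≤hub-hub = hittingTimeTo-nonneg (hitting-to hub) Ĥ-connected hub

    -- Kac's formula at the hub gives Σ_j [A v j] h(j, v) = 2μ - d_v, and each of the d_v
    -- neighbours of v contributes at least 1.
    deg≤μ : degℚ A v ≤ μ
    deg≤μ = half {degℚ A v} {μ} (begin
      degℚ A v
        ≡⟨ sym (trans (cong (_-_ (degℚ A v)) no-loop) (+-identityʳ (degℚ A v))) ⟩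
      degℚ A v - [ A v v ]
        ≡⟨ cong (_- [ A v v ]) (degℚ≡∑ A v) ⟩
      ∑[ j < n ] [ A v j ] - [ A v v ]
        ≤⟨ ∑-off-target (λ j → [ A v j ]) (λ j → h (old j) hub) v ([]-nonneg ∘ A v) 0≤hub-hub 1≤to-hub ⟩
      ∑[ j < n ] ([ A v j ] * h (old j) hub)
        ≡⟨ return-to-hub ⟩
      2 * μ - degℚ A v ∎)
      where
      open ≤-Reasoning
      no-loop : [ A v v ] ≡ 0ℚ
      no-loop = cong [_] (proj₂ simple v)
      half : ∀ {d μ} → d ≤ 2 * μ - d → d ≤ μ
      half {d} {μ} d≤2μ-d = 0≤q-p⇒p≤q (*-cancelˡ-≤-pos 2 (subst₂ _≤_ (sym (*-zeroʳ 2)) (factor d μ) (p≤q⇒0≤q-p d≤2μ-d)))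
        where
        factor : ∀ d μ → 2 * μ - d - d ≡ 2 * (μ - d)
        factor = solve-∀ ℚ-ring

    B : ℚ
    B = ∑[ j < n ] (degℚ Ĥ (old j) * h (old j) hub)

    μ≤B : μ ≤ B
    μ≤B = begin
      μ
        ≤⟨ 0≤q-p⇒p≤q (subst (0ℚ ≤_) (sym (shift μ (degℚ A v))) (p≤q⇒0≤q-p deg≤μ)) ⟩
      2 * μ - degℚ A v
        ≡⟨ sym (cancel-3 (2 * μ) (degℚ A v)) ⟩
      (3 + 2 * μ) - (3 + degℚ A v)
        ≡⟨ sym (cong₂ _-_ (trans ∑-old-deg (cong (3 +_) (handshake simple))) hub-deg) ⟩
      ∑[ j < n ] degℚ Ĥ (old j) - degℚ Ĥ hub
        ≤⟨ ∑-off-target (λ j → degℚ Ĥ (old j)) (λ j → h (old j) hub) v (λ j → degℚ-nonneg Ĥ (old j)) 0≤hub-hub 1≤to-hub ⟩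
      B ∎
      where
      open ≤-Reasoning
      shift : ∀ μ d → 2 * μ - d - μ ≡ μ - d
      shift = solve-∀ ℚ-ring
      cancel-3 : ∀ m d → (3 + m) - (3 + d) ≡ m - d
      cancel-3 = solve-∀ ℚ-ring

  -- Hitting times in G*

  module Star {n} {A : Adj n} {v : Fin n} (simple : IsSimple A) (connected : Connected A)
              {h : Fin (3 ℕ.+ n) → Fin (3 ℕ.+ n) → ℚ} (hat-hitting : IsHittingTimes (hatAdj A v) h)
              {s : Fin (3 ℕ.+ n) → Fin (3 ℕ.+ n) → ℚ} (star-hitting : IsHittingTimes (starAdj A v) s) where

    private
      module Ĝ = Hat simple connected hat-hitting
    open Ĝ using (μ)

    Ŝ : Adj (3 ℕ.+ n)
    Ŝ = starAdj A v

    glued : IsGluedAt A v Ŝ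
    glued = addEdge-gluedAt Ĝ.glued zero (suc (suc zero))

    open GluedAt glued public

    Ŝ-simple : IsSimple Ŝ
    Ŝ-simple = gluedAt-isSimple glued simple (from-yes (isSimple? (gadget Ŝ)))

    Ŝ-connected : Connected Ŝ
    Ŝ-connected = gluedAt-connected glued connected

    ∑deg : ∑[ x < 3 ℕ.+ n ] degℚ Ŝ x ≡ 12 + 2 * μ
    ∑deg = trans (cong₂ _+_ (new-deg zero) (cong₂ _+_ (new-deg (suc zero)) (cong₂ _+_ (new-deg (suc (suc zero)))
                   (trans ∑-old-deg (cong (3 +_) (handshake simple))))))
                 (tally μ)
      where
      tally : ∀ μ → 3 + (3 + (3 + (3 + 2 * μ))) ≡ 12 + 2 * μ
      tally = solve-∀ ℚ-ring

    hitting-to : ∀ t → IsHittingTimeTo Ŝ t (λ x → s x t)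
    hitting-to = isHittingTimeTo star-hitting

    row-a : ∀ g → ∑[ k < 3 ℕ.+ n ] ([ Ŝ va k ] * g k) ≡ g vb + g vc + g hub
    row-a g = trans (new-row zero g) (tidy (g va) (g vb) (g vc) (g hub))
      where
      tidy : ∀ p q r s → [ false ] * p + ([ true ] * q + ([ true ] * r + 0ℚ)) + s ≡ q + r + s
      tidy = solve-∀ ℚ-ring

    row-b : ∀ g → ∑[ k < 3 ℕ.+ n ] ([ Ŝ vb k ] * g k) ≡ g vc + g va + g hub
    row-b g = trans (new-row (suc zero) g) (tidy (g va) (g vb) (g vc) (g hub))
      where
      tidy : ∀ p q r s → [ true ] * p + ([ false ] * q + ([ true ] * r + 0ℚ)) + s ≡ r + p + s
      tidy = solve-∀ ℚ-ring

    row-c : ∀ g → ∑[ k < 3 ℕ.+ n ] ([ Ŝ vc k ] * g k) ≡ g va + g vb + g hub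
    row-c g = trans (new-row (suc (suc zero)) g) (tidy (g va) (g vb) (g vc) (g hub))
      where
      tidy : ∀ p q r s → [ true ] * p + ([ true ] * q + ([ false ] * r + 0ℚ)) + s ≡ p + q + s
      tidy = solve-∀ ℚ-ring

    first-step-a : ∀ g → FirstStepAt Ŝ g va ⇔ (3 * g va ≡ 3 + (g vb + g vc + g hub))
    first-step-a g = FirstStepAt-⇔ {A = Ŝ} {g = g} {i = va} (new-deg zero) (row-a g)

    first-step-b : ∀ g → FirstStepAt Ŝ g vb ⇔ (3 * g vb ≡ 3 + (g vc + g va + g hub))
    first-step-b g = FirstStepAt-⇔ {A = Ŝ} {g = g} {i = vb} (new-deg (suc zero)) (row-b g)

    first-step-c : ∀ g → FirstStepAt Ŝ g vc ⇔ (3 * g vc ≡ 3 + (g va + g vb + g hub))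
    first-step-c g = FirstStepAt-⇔ {A = Ŝ} {g = g} {i = vc} (new-deg (suc (suc zero))) (row-c g)

    private
      equation : ∀ {t} x → new x ≢ t → FirstStepAt Ŝ (λ y → s y t) (new x)
      equation {t} x x≢t = IsHittingTimeTo.first-step (hitting-to t) (new x) x≢t

      kac-new : ∀ x → degℚ Ŝ (new x) + ∑[ k < 3 ℕ.+ n ] ([ Ŝ (new x) k ] * s k (new x)) ≡ 12 + 2 * μ
      kac-new x = trans (kac (proj₁ Ŝ-simple) (hitting-to (new x))) ∑deg

    hub-to-a : s hub va ≡ μ + 3
    hub-to-a = triangle-target {q = s vb va} {s vc va} {s hub va} {μ} (IsHittingTimeTo.at-target (hitting-to va))
      (trans (sym (cong₂ _+_ (new-deg zero) (row-a (λ x → s x va)))) (kac-new zero))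
      (Equivalence.to (first-step-b (λ x → s x va)) (equation (suc zero) λ ()))
      (Equivalence.to (first-step-c (λ x → s x va)) (equation (suc (suc zero)) λ ()))

    hub-to-b : s hub vb ≡ μ + 3
    hub-to-b = triangle-target {q = s vc vb} {s va vb} {s hub vb} {μ} (IsHittingTimeTo.at-target (hitting-to vb))
      (trans (sym (cong₂ _+_ (new-deg (suc zero)) (row-b (λ x → s x vb)))) (kac-new (suc zero)))
      (Equivalence.to (first-step-c (λ x → s x vb)) (equation (suc (suc zero)) λ ()))
      (Equivalence.to (first-step-a (λ x → s x vb)) (equation zero λ ()))

    hub-to-c : s hub vc ≡ μ + 3
    hub-to-c = triangle-target {q = s va vc} {s vb vc} {s hub vc} {μ} (IsHittingTimeTo.at-target (hitting-to vc))
      (trans (sym (cong₂ _+_ (new-deg (suc (suc zero))) (row-c (λ x → s x vc)))) (kac-new (suc (suc zero))))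
      (Equivalence.to (first-step-a (λ x → s x vc)) (equation zero λ ()))
      (Equivalence.to (first-step-b (λ x → s x vc)) (equation (suc zero) λ ()))

    ε : ℚ
    ε = inv (μ + 5)

    ε-eq : ε * (μ + 5) ≡ 1ℚ
    ε-eq = trans (*-comm ε (μ + 5)) (*-inv (μ + 5) (λ μ+5≡0 → <-irrefl (sym μ+5≡0) 0<μ+5))
      where
      0<μ+5 : 0ℚ < μ + 5
      0<μ+5 = <-≤-trans (positive⁻¹ 5) (subst (_≤ μ + 5) (+-identityˡ 5) (+-monoˡ-≤ 5 (toℚ-nonneg (numEdges A))))

    candidate : Fin n → Fin (3 ℕ.+ n) → ℚ
    candidate j (suc (suc (suc i))) = (1ℚ + ε) * h (old i) (old j) + (- ε) * h (old i) hub + ε * h (old j) hub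
    candidate j _                   = 3 + candidate j hub

    candidate-hitting : ∀ j → IsHittingTimeTo Ŝ (old j) (candidate j)
    candidate-hitting j = hittingTimeTo-old at-target gadget-step hub-step other-step
      where
      t : Fin (3 ℕ.+ n)
      t = old j
      at-target : candidate j t ≡ 0ℚ
      at-target = combine₁ (1ℚ + ε) (certificate ε (h t t) (h t hub)) (IsHittingTimeTo.at-target (Ĝ.hitting-to t))
        where
        certificate : ∀ e x y → (1ℚ + e) * x + (- e) * y + e * y - 0ℚ ≡ (1ℚ + e) * (x - 0ℚ)
        certificate = solve-∀ ℚ-ring
      gadget-eq : ∀ F → 3 * (3 + F) ≡ 3 + ((3 + F) + (3 + F) + F)
      gadget-eq = solve-∀ ℚ-ring
      gadget-step : ∀ x → FirstStepAt Ŝ (candidate j) (new x)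
      gadget-step zero             = Equivalence.from (first-step-a (candidate j)) (gadget-eq (candidate j hub))
      gadget-step (suc zero)       = Equivalence.from (first-step-b (candidate j)) (gadget-eq (candidate j hub))
      gadget-step (suc (suc zero)) = Equivalence.from (first-step-c (candidate j)) (gadget-eq (candidate j hub))
      candidate-neighbour-sum : ∀ i → ∑[ k < n ] ([ A i k ] * candidate j (old k))
        ≡ (1ℚ + ε) * ∑[ k < n ] ([ A i k ] * h (old k) t) + (- ε) * ∑[ k < n ] ([ A i k ] * h (old k) hub)
          + ε * h t hub * degℚ A i
      candidate-neighbour-sum i = trans (∑-linear (λ k → [ A i k ]) (λ k → h (old k) t) (λ k → h (old k) hub) (1ℚ + ε) (- ε) (ε * h t hub))
                              (cong (λ d → (1ℚ + ε) * ∑[ k < n ] ([ A i k ] * h (old k) t) + (- ε) * ∑[ k < n ] ([ A i k ] * h (old k) hub)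
                                           + ε * h t hub * d) (sym (degℚ≡∑ A i)))
      hub-step : j ≢ v → (3 + degℚ A v) * candidate j hub
        ≡ (3 + degℚ A v) + ((candidate j va + candidate j vb + candidate j vc) + ∑[ k < n ] ([ A v k ] * candidate j (old k)))
      hub-step j≢v = trans
        (combine₄ (1ℚ + ε) ε 2 (- (ε * degℚ A v))
          (certificate (degℚ A v) (h hub t) (h hub hub) (h t hub) S K ε μ)
          (Ĝ.hub-step j≢v) Ĝ.return-to-hub ε-eq (IsHittingTimeTo.at-target (Ĝ.hitting-to hub)))
        (cong (λ σ → (3 + degℚ A v) + ((candidate j va + candidate j vb + candidate j vc) + σ)) (sym (candidate-neighbour-sum v)))
        where
        S K : ℚ
        S = ∑[ k < n ] ([ A v k ] * h (old k) t)
        K = ∑[ k < n ] ([ A v k ] * h (old k) hub)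
        certificate : ∀ d H z T S K e μ →
          (3 + d) * ((1ℚ + e) * H + (- e) * z + e * T)
            - ((3 + d) + ((3 + ((1ℚ + e) * H + (- e) * z + e * T)) + (3 + ((1ℚ + e) * H + (- e) * z + e * T))
                          + (3 + ((1ℚ + e) * H + (- e) * z + e * T)) + ((1ℚ + e) * S + (- e) * K + e * T * d)))
          ≡ (1ℚ + e) * (d * H - (d + 10 + S)) + e * (K - (2 * μ - d)) + 2 * (e * (μ + 5) - 1ℚ) + - (e * d) * (z - 0ℚ)
        certificate = solve-∀ ℚ-ring
      other-step : ∀ i → i ≢ v → i ≢ j → FirstStepAt A (candidate j ∘ old) i
      other-step i i≢v i≢j = trans
        (combine₂ (1ℚ + ε) (- ε)
          (certificate (degℚ A i) (h (old i) t) (h (old i) hub) (h t hub)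
                       (∑[ k < n ] ([ A i k ] * h (old k) t)) (∑[ k < n ] ([ A i k ] * h (old k) hub)) ε)
          (Ĝ.other-step i≢v (i≢j ∘ old-injective)) (Ĝ.other-step i≢v (i≢v ∘ old-injective)))
        (cong (degℚ A i +_) (sym (candidate-neighbour-sum i)))
        where
        certificate : ∀ d x y T St Sh e →
          d * ((1ℚ + e) * x + (- e) * y + e * T) - (d + ((1ℚ + e) * St + (- e) * Sh + e * T * d))
          ≡ (1ℚ + e) * (d * x - (d + St)) + (- e) * (d * y - (d + Sh))
        certificate = solve-∀ ℚ-ring

    hub-to-old : ∀ j → s hub (old j) ≡ (1ℚ + ε) * h hub (old j) + (- ε) * h hub hub + ε * h (old j) hub
    hub-to-old j = hittingTimeTo-unique (hitting-to (old j)) Ŝ-connected (candidate-hitting j) hub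

  -- Comparing the Kemeny constants

  inv-pos : ∀ {p} → 0ℚ < p → 0ℚ < inv p
  inv-pos {p} 0<p with p ≟ 0ℚ
  ... | yes p≡0 = ⊥-elim (<-irrefl (sym p≡0) 0<p)
  ... | no  _   = positive⁻¹ _ {{1/pos⇒pos p {{positive 0<p}}}}

  inv-<-cross : ∀ {p q x y} → 0ℚ < p → 0ℚ < q → 0ℚ < p * y - q * x → inv p * x < inv q * y
  inv-<-cross {p} {q} {x} {y} 0<p 0<q 0<py-qx =
    0<q-p⇒p<q (subst (0ℚ <_) (sym difference) (0<*0< (0<*0< (inv-pos 0<p) (inv-pos 0<q)) 0<py-qx))
    where
    0<*0< : ∀ {a b} → 0ℚ < a → 0ℚ < b → 0ℚ < a * b
    0<*0< {a} {b} 0<a 0<b = positive⁻¹ (a * b) {{pos*pos⇒pos a {{positive 0<a}} b {{positive 0<b}}}}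
    difference : inv q * y - inv p * x ≡ inv p * inv q * (p * y - q * x)
    difference = combine₂ (- (inv q * y)) (inv p * x) (certificate p q x y (inv p) (inv q))
                   (*-inv p (λ p≡0 → <-irrefl (sym p≡0) 0<p)) (*-inv q (λ q≡0 → <-irrefl (sym q≡0) 0<q))
      where
      certificate : ∀ p q x y a b → b * y - a * x - a * b * (p * y - q * x) ≡ - (b * y) * (p * a - 1ℚ) + a * x * (q * b - 1ℚ)
      certificate = solve-∀ ℚ-ring

  module Comparison {n} {A : Adj n} {v : Fin n} (simple : IsSimple A) (connected : Connected A) (2≤m : 2 ℕ.≤ numEdges A)
                    {h : Fin (3 ℕ.+ n) → Fin (3 ℕ.+ n) → ℚ} (hat-hitting : IsHittingTimes (hatAdj A v) h)
                    {s : Fin (3 ℕ.+ n) → Fin (3 ℕ.+ n) → ℚ} (star-hitting : IsHittingTimes (starAdj A v) s) where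

    private
      module Ĝ = Hat simple connected hat-hitting
      module G* = Star simple connected hat-hitting star-hitting
    open Ĝ using (μ; hub; B)
    open G* using (ε)

    W : ℚ
    W = ∑[ j < n ] (degℚ Ĝ.Ĥ (old j) * h hub (old j))

    hat-sum : kemenySum Ĝ.Ĥ h hub ≡ 2 * (5 / 4 * μ + 4) + (3 * (μ + 5 / 2) + (2 * (5 / 4 * μ + 4) + W))
    hat-sum = cong₂ _+_ (cong₂ _*_ (Ĝ.new-deg zero) Ĝ.hub-to-a)
             (cong₂ _+_ (cong₂ _*_ (Ĝ.new-deg (suc zero)) Ĝ.hub-to-b)
             (cong₂ _+_ (cong₂ _*_ (Ĝ.new-deg (suc (suc zero))) Ĝ.hub-to-c) refl))

    star-sum : kemenySum G*.Ŝ s hub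
      ≡ 3 * (μ + 3) + (3 * (μ + 3) + (3 * (μ + 3) + ((1ℚ + ε) * W + ε * B + (- ε) * h hub hub * (3 + 2 * μ))))
    star-sum = cong₂ _+_ (cong₂ _*_ (G*.new-deg zero) G*.hub-to-a)
              (cong₂ _+_ (cong₂ _*_ (G*.new-deg (suc zero)) G*.hub-to-b)
              (cong₂ _+_ (cong₂ _*_ (G*.new-deg (suc (suc zero))) G*.hub-to-c) old-part))
      where
      same-deg : ∀ j → degℚ G*.Ŝ (old j) ≡ degℚ Ĝ.Ĥ (old j)
      same-deg j = trans (G*.old-deg j) (sym (Ĝ.old-deg j))
      reorder : ∀ d x z y e → d * ((1ℚ + e) * x + (- e) * z + e * y) ≡ d * ((1ℚ + e) * x + e * y + (- e) * z)
      reorder = solve-∀ ℚ-ring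
      old-part : ∑[ j < n ] (degℚ G*.Ŝ (old j) * s hub (old j)) ≡ (1ℚ + ε) * W + ε * B + (- ε) * h hub hub * (3 + 2 * μ)
      old-part = begin
        ∑[ j < n ] (degℚ G*.Ŝ (old j) * s hub (old j))
          ≡⟨ sum-cong-≗ (λ j → trans (cong₂ _*_ (same-deg j) (G*.hub-to-old j))
                                     (reorder (degℚ Ĝ.Ĥ (old j)) (h hub (old j)) (h hub hub) (h (old j) hub) ε)) ⟩
        ∑[ j < n ] (degℚ Ĝ.Ĥ (old j) * ((1ℚ + ε) * h hub (old j) + ε * h (old j) hub + (- ε) * h hub hub))
          ≡⟨ ∑-linear (λ j → degℚ Ĝ.Ĥ (old j)) (λ j → h hub (old j)) (λ j → h (old j) hub) (1ℚ + ε) ε ((- ε) * h hub hub) ⟩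
        (1ℚ + ε) * W + ε * B + (- ε) * h hub hub * ∑[ j < n ] degℚ Ĝ.Ĥ (old j)
          ≡⟨ cong (λ d → (1ℚ + ε) * W + ε * B + (- ε) * h hub hub * d) (trans Ĝ.∑-old-deg (cong (3 +_) (handshake simple))) ⟩
        (1ℚ + ε) * W + ε * B + (- ε) * h hub hub * (3 + 2 * μ) ∎
        where open ≡-Reasoning

    cleared-difference : (10 + 2 * μ) * kemenySum G*.Ŝ s hub - (12 + 2 * μ) * kemenySum Ĝ.Ĥ h hub ≡ 2 * B + 2 * (μ * μ) + μ - 12
    cleared-difference = trans (cong₂ (λ x y → (10 + 2 * μ) * y - (12 + 2 * μ) * x) hat-sum star-sum)
      (combine₂ (2 * W + 2 * B) (- ((10 + 2 * μ) * ε * (3 + 2 * μ))) (certificate μ W B ε (h hub hub))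
        G*.ε-eq (IsHittingTimeTo.at-target (Ĝ.hitting-to hub)))
      where
      certificate : ∀ μ W B e z →
        (10 + 2 * μ) * (3 * (μ + 3) + (3 * (μ + 3) + (3 * (μ + 3) + ((1ℚ + e) * W + e * B + (- e) * z * (3 + 2 * μ)))))
          - (12 + 2 * μ) * (2 * (5 / 4 * μ + 4) + (3 * (μ + 5 / 2) + (2 * (5 / 4 * μ + 4) + W)))
          - (2 * B + 2 * (μ * μ) + μ - 12)
        ≡ (2 * W + 2 * B) * (e * (μ + 5) - 1ℚ) + - ((10 + 2 * μ) * e * (3 + 2 * μ)) * (z - 0ℚ)
      certificate = solve-∀ ℚ-ring

    cleared-difference-pos : 0ℚ < 2 * B + 2 * (μ * μ) + μ - 12
    cleared-difference-pos = begin-strict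
      0ℚ
        <⟨ positive⁻¹ 2 ⟩
      2
        ≡⟨ sym (+-identityʳ 2) ⟩
      2 + 0ℚ
        ≤⟨ +-monoʳ-≤ 2 (subst (_≤ 2 * (B - μ) + (μ - 2) * (2 * μ + 7)) (+-identityʳ 0ℚ)
                         (+-mono-≤ (0≤2* (p≤q⇒0≤q-p Ĝ.μ≤B)) (0≤*0≤ (p≤q⇒0≤q-p 2≤μ) 0≤2μ+7))) ⟩
      2 + (2 * (B - μ) + (μ - 2) * (2 * μ + 7))
        ≡⟨ sym (split B μ) ⟩
      2 * B + 2 * (μ * μ) + μ - 12 ∎
      where
      open ≤-Reasoning
      split : ∀ B μ → 2 * B + 2 * (μ * μ) + μ - 12 ≡ 2 + (2 * (B - μ) + (μ - 2) * (2 * μ + 7))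
      split = solve-∀ ℚ-ring
      0≤2* : ∀ {x} → 0ℚ ≤ x → 0ℚ ≤ 2 * x
      0≤2* = 0≤*0≤ (nonNegative⁻¹ 2)
      2≤μ : 2 ≤ μ
      2≤μ = toℚ-mono-≤ 2≤m
      0≤2μ+7 : 0ℚ ≤ 2 * μ + 7
      0≤2μ+7 = subst (_≤ 2 * μ + 7) (+-identityʳ 0ℚ) (+-mono-≤ (0≤2* (toℚ-nonneg (numEdges A))) (nonNegative⁻¹ 7))

    kemenyAt-hub : kemenyAt Ĝ.Ĥ h hub < kemenyAt G*.Ŝ s hub
    kemenyAt-hub = begin-strict
      kemenyAt Ĝ.Ĥ h hub
        ≡⟨ trans (kemenyAt≡ Ĝ.Ĥ h hub) (cong (λ p → inv p * kemenySum Ĝ.Ĥ h hub) (two-edges Ĝ.Ĥ-simple Ĝ.∑deg)) ⟩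
      inv (10 + 2 * μ) * kemenySum Ĝ.Ĥ h hub
        <⟨ inv-<-cross (0<+2μ (positive⁻¹ 10)) (0<+2μ (positive⁻¹ 12)) (subst (0ℚ <_) (sym cleared-difference) cleared-difference-pos) ⟩
      inv (12 + 2 * μ) * kemenySum G*.Ŝ s hub
        ≡⟨ sym (trans (kemenyAt≡ G*.Ŝ s hub) (cong (λ p → inv p * kemenySum G*.Ŝ s hub) (two-edges G*.Ŝ-simple G*.∑deg))) ⟩
      kemenyAt G*.Ŝ s hub ∎
      where
      open ≤-Reasoning
      two-edges : ∀ {H : Adj (3 ℕ.+ n)} {D} → IsSimple H → ∑[ x < 3 ℕ.+ n ] degℚ H x ≡ D → toℚ (2 ℕ.* numEdges H) ≡ D
      two-edges {H} simple-H ∑deg≡D = trans (toℚ-2* (numEdges H)) (trans (sym (handshake simple-H)) ∑deg≡D)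
      0<+2μ : ∀ {c} → 0ℚ < c → 0ℚ < c + 2 * μ
      0<+2μ {c} 0<c = <-≤-trans 0<c (subst (_≤ c + 2 * μ) (+-identityʳ c)
                        (+-monoʳ-≤ c (0≤*0≤ (nonNegative⁻¹ 2) (toℚ-nonneg (numEdges A)))))

open import Data.Nat using (ℕ; _≤_; _+_)
open import Data.Fin using (Fin)
open import Data.Rational using (ℚ; _<_)
open import Data.Rational.Properties using (module ≤-Reasoning)

theorem4p13 : ∀ {n : ℕ} (A : Adj n) (v : Fin n)
    → IsSimple A → Connected A → 2 ≤ numEdges A
    → (hh hs : Fin (3 + n) → Fin (3 + n) → ℚ)
    → IsHittingTimes (hatAdj A v) hh
    → IsHittingTimes (starAdj A v) hs
    → (i : Fin (3 + n))
    → kemenyAt (hatAdj A v) hh i < kemenyAt (starAdj A v) hs i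
theorem4p13 A v simple connected 2≤m hh hs hat-hitting star-hitting i = begin-strict
  kemenyAt (hatAdj A v) hh i       ≡⟨ kemenyAt-independent Ĝ.Ĥ-simple Ĝ.Ĥ-connected hat-hitting i Ĝ.hub ⟩
  kemenyAt (hatAdj A v) hh Ĝ.hub   <⟨ Comparison.kemenyAt-hub simple connected 2≤m hat-hitting star-hitting ⟩
  kemenyAt (starAdj A v) hs Ĝ.hub  ≡⟨ kemenyAt-independent G*.Ŝ-simple G*.Ŝ-connected star-hitting Ĝ.hub i ⟩
  kemenyAt (starAdj A v) hs i ∎
  where
  open ≤-Reasoning
  module Ĝ = Hat simple connected hat-hitting
  module G* = Star simple connected hat-hitting star-hitting
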